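{- Let $R$ be a Pr\"ufer domain such that $R_{\mathfrak{n}}$ has dense value group for every maximal ideal $\mathfrak{n}$. Let $b,c,d\in R$, let $\mathfrak{m}$ be a maximal ideal of $R$, $\gamma\in R\setminus\{0\}$ and $\delta\in\mathfrak{m}\setminus\{0\}$. Then: (1) $x=x\,/\,xd=0$ is a minimal pair for $R_{\mathfrak{m}}/\gamma\mathfrak{m}R_{\mathfrak{m}}$ if and only if $\gamma R_{\mathfrak{m}}=dR_{\mathfrak{m}}$; (2) $xb=0\,/\,c\mid x$ is a minimal pair for $R_{\mathfrak{m}}/\gamma\mathfrak{m}R_{\mathfrak{m}}$ if and only if $\gamma\notin\mathfrak{m}$, $b\in\mathfrak{m}$ and $c\in\mathfrak{m}$; (3) $x=x\,/\,xd=0$ is never a minimal pair for $\mathfrak{m}R_{\mathfrak{m}}/\delta R_{\mathfrak{m}}$; (4) $xb=0\,/\,c\mid x$ is a minimal pair for $\mathfrak{m}R_{\mathfrak{m}}/\delta R_{\mathfrak{m}}$ if and only if $c\in\mathfrak{m}R_{\mathfrak{m}}$, $b\in\mathfrak{m}R_{\mathfrak{m}}$ and $bcR_{\mathfrak{m}}=\delta R_{\mathfrak{m}}$.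
   Context: A Pr\"ufer domain is a commutative domain all of whose localizations at maximal ideals are valuation domains; a valuation domain has dense value group if its value group has no least positive element. The modules are regarded as $R$-modules. $c\mid x$ abbreviates $\exists y\,(yc=x)$. A pp-pair $\phi/\psi$ (pair of pp-formulas in one variable, over $R$) is a minimal pair for a module $N$ if $\phi(N)\supsetneq\phi(N)\cap\psi(N)$ and there is no pp-formula $\theta$ with $\phi(N)\supsetneq\theta(N)\supsetneq\phi(N)\cap\psi(N)$. -}

module Defs where

open import Level using (0ℓ)
open import Algebra.Bundles using (CommutativeRing)
open import Data.Nat using (ℕ; suc)
open import Data.Fin using (Fin; zero; suc)
open import Data.List using (List; []; _∷_; _++_; foldr)
open import Data.Product using (Σ; _×_; _,_; proj₁; ∃)
open import Data.Sum using (_⊎_)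
open import Relation.Nullary using (¬_)

-- Generic "structure for pp-formulas": a set with an equality, addition,
-- zero and a scalar action of the ring carrier.  (Only these operations are
-- needed to interpret pp-formulas; the concrete modules below are the
-- genuine R-modules of the paper.)
record PPStr (A : Set) : Set₁ where
  field
    Car   : Set
    _≈M_  : Car → Car → Set
    _+M_  : Car → Car → Car
    0M    : Car
    _·M_  : A → Car → Car

module _ (R : CommutativeRing 0ℓ 0ℓ) where
  open CommutativeRing R hiding (zero)

  _−_ : Carrier → Carrier → Carrier
  x − y = x + (- y)

  IsDomain : Set
  IsDomain = (¬ (1# ≈ 0#)) × (∀ x y → x * y ≈ 0# → (x ≈ 0#) ⊎ (y ≈ 0#))

  record IsIdeal (P : Carrier → Set) : Set where
    field
      resp  : ∀ {x y} → x ≈ y → P x → P y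
      zero∈ : P 0#
      add∈  : ∀ {x y} → P x → P y → P (x + y)
      mul∈  : ∀ r {x} → P x → P (r * x)

  record IsMaximal (P : Carrier → Set) : Set₁ where
    field
      ideal  : IsIdeal P
      proper : ¬ P 1#
      max    : (J : Carrier → Set) → IsIdeal J → (∀ x → P x → J x) →
               (∀ x → J x → P x) ⊎ J 1#

  -- Denominators are finite products of elements outside m (the
  -- multiplicative set generated by R∖m, which is R∖m itself for m prime).
  module Loc (m : Carrier → Set) where
    Den : Set
    Den = List (Σ Carrier λ s → ¬ m s)

    prodD : Den → Carrier
    prodD = foldr (λ p acc → proj₁ p * acc) 1#

    Frac : Set
    Frac = Carrier × Den

    _~_ : Frac → Frac → Set
    (r , S) ~ (r' , S') = Σ Den λ T → prodD T * ((r * prodD S') − (r' * prodD S)) ≈ 0#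

    _+F_ : Frac → Frac → Frac
    (r , S) +F (r' , S') = ((r * prodD S') + (r' * prodD S)) , (S ++ S')

    _*F_ : Frac → Frac → Frac
    (r , S) *F (r' , S') = (r * r') , (S ++ S')

    -F_ : Frac → Frac
    -F (r , S) = (- r) , S

    _-F_ : Frac → Frac → Frac
    a -F b = a +F (-F b)

    0F 1F : Frac
    0F = 0# , []
    1F = 1# , []

    ι : Carrier → Frac
    ι r = r , []

    _∣L_ : Frac → Frac → Set
    a ∣L b = Σ Frac λ u → b ~ (a *F u)

    IsUnit : Frac → Set
    IsUnit a = a ∣L 1F

    SamePrincipal : Frac → Frac → Set
    SamePrincipal a b = (a ∣L b) × (b ∣L a)

    InmRm : Frac → Set
    InmRm a = Σ Carrier λ r → Σ Den λ S → m r × (a ~ (r , S))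

    -- R_m is a valuation domain (R_m is a domain since R is)
    IsValuation : Set
    IsValuation = ∀ a b → (a ∣L b) ⊎ (b ∣L a)

    -- the value group of R_m has no least positive element: positive
    -- elements are values of nonzero nonunits; for every such a there is
    -- a positive h = v(b) with v(b) < v(a), i.e. a = b c with c a nonunit.
    DenseValueGroup : Set
    DenseValueGroup = ∀ a → ¬ (a ~ 0F) → ¬ IsUnit a →
      Σ Frac λ b → Σ Frac λ c →
        (¬ (b ~ 0F)) × (¬ IsUnit b) × (¬ IsUnit c) × (a ~ (b *F c))

    QuotγmRm : Carrier → PPStr Carrier
    QuotγmRm γ = record
      { Car  = Frac
      ; _≈M_ = λ a a' → Σ Carrier λ r → Σ Den λ S → m r × ((a -F a') ~ (γ * r , S))
      ; _+M_ = _+F_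
      ; 0M   = 0F
      ; _·M_ = λ r a → ι r *F a
      }

    -- the R-module m R_m / δ R_m ; elements of m R_m are fractions r/S with r ∈ m
    module MR (mI : IsIdeal m) where
      open IsIdeal mI
      MFrac : Set
      MFrac = Σ Carrier m × Den

      und : MFrac → Frac
      und ((r , _) , S) = r , S

      QuotmRmδ : Carrier → PPStr Carrier
      QuotmRmδ δ = record
        { Car  = MFrac
        ; _≈M_ = λ a a' → (ι δ) ∣L (und a -F und a')
        ; _+M_ = λ { ((r , p) , S) ((r' , p') , S') →
                     ((prodD S' * r + prodD S * r') ,
                       add∈ (mul∈ (prodD S') p) (mul∈ (prodD S) p')) , (S ++ S') }
        ; 0M   = (0# , zero∈) , []
        ; _·M_ = λ a x → ((a * proj₁ (proj₁ x)) , mul∈ a (Data.Product.proj₂ (proj₁ x))) ,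
                         Data.Product.proj₂ x
        }

  IsPrufer : Set₁
  IsPrufer = ∀ n → IsMaximal n → Loc.IsValuation n

  AllDense : Set₁
  AllDense = ∀ n → IsMaximal n → Loc.DenseValueGroup n

  -- pp-formulas in one free variable x:  ∃ y₁..y_k ⋀_{i<l} Σ_j a_ij z_j = 0,
  -- where z₀ = x and z_{j+1} = y_{j+1}.
  record PP : Set where
    constructor pp
    field
      k l   : ℕ
      coeff : Fin l → Fin (suc k) → Carrier

  module _ (N : PPStr Carrier) where
    open PPStr N

    sumM : ∀ {n} → (Fin n → Car) → Car
    sumM {ℕ.zero} f = 0M
    sumM {suc n} f = f zero +M sumM (λ j → f (suc j))

    cons : ∀ {k} → Car → (Fin k → Car) → Fin (suc k) → Car
    cons x ys zero = x
    cons x ys (suc j) = ys j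

    ⟦_⟧ : PP → Car → Set
    ⟦ pp k l a ⟧ x = Σ (Fin k → Car) λ ys →
      ∀ i → sumM (λ j → a i j ·M cons x ys j) ≈M 0M

    _⊆_ : (Car → Set) → (Car → Set) → Set
    P ⊆ Q = ∀ x → P x → Q x

    _⊊_ : (Car → Set) → (Car → Set) → Set
    P ⊊ Q = (P ⊆ Q) × (Σ Car λ x → Q x × ¬ P x)

    MinimalPair : PP → PP → Set
    MinimalPair φ ψ =
      ((λ x → ⟦ φ ⟧ x × ⟦ ψ ⟧ x) ⊊ ⟦ φ ⟧) ×
      (¬ (Σ PP λ θ → (⟦ θ ⟧ ⊊ ⟦ φ ⟧) × ((λ x → ⟦ φ ⟧ x × ⟦ ψ ⟧ x) ⊊ ⟦ θ ⟧)))

  ppTrue : PP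
  ppTrue = pp 0 0 (λ ())

  ppAnn : Carrier → PP
  ppAnn r = pp 0 1 (λ _ _ → r)

  -- the formula c ∣ x, i.e. ∃ y (y c = x), written x·1 + y·(-c) = 0
  ppDiv : Carrier → PP
  ppDiv c = pp 1 1 (λ { _ zero → 1# ; _ (suc _) → - c })

-- Work with the valuation v of R_m, encoded in R by a ≼ b (v a ≤ v b) and a ≺ b (v a < v b).
-- Elements of both modules are fractions, and the sets defined by x = x, x d = 0 and c ∣ x are
-- cut out by inequalities on the value of the numerator. If φ and φ ∧ ψ are the cuts v ≥ t and
-- v > t at one value t, every x ∈ φ outside φ ∧ ψ is c times a unit and generates φ modulo φ ∧ ψ,
-- so the pair is minimal. Otherwise density of the value group provides a value strictly between
-- the two cuts, and a formula x d′ = 0 or c′ ∣ x at that value lies strictly between φ and φ ∧ ψ.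
module Submission where

open import Level using (Level; 0ℓ)
open import Algebra.Bundles using (CommutativeRing)
open import Algebra.Solver.Ring.AlmostCommutativeRing using (fromCommutativeRing; _-Raw-AlmostCommutative⟶_)
open import Data.Empty using (⊥)
open import Data.Fin using (Fin) renaming (zero to fzero; suc to fsuc)
open import Data.Integer as ℤ using (ℤ; +_; -[1+_]; _⊖_; _◃_; sign; ∣_∣)
import Data.Integer.Properties as ℤ
open import Data.List using ([]; _∷_; _++_)
open import Data.Maybe using (Maybe; just; nothing)
open import Data.Nat as ℕ using (ℕ; zero; suc)
import Data.Nat.Properties as ℕ
open import Data.Product using (_×_; Σ; _,_; proj₁; proj₂)
open import Data.Sign as Sign using (Sign)
open import Data.Sum using (_⊎_; inj₁; inj₂; [_,_]′)
open import Function using (_∘_; _⇔_; mk⇔)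
import Relation.Binary.PropositionalEquality as ≡
open import Relation.Nullary using (¬_; Dec; yes; no; contradiction)
open import Relation.Nullary.Decidable using (decidable-stable)
open import Defs

-- The standard library instantiates Algebra.Solver.Ring only with ℕ coefficients, which cannot
-- express subtraction; here ℤ is mapped into an arbitrary commutative ring instead.
module IntegerCoefficients {c ℓ : Level} (R : CommutativeRing c ℓ) where
  open CommutativeRing R
  open import Algebra.Properties.Ring ring using (-‿involutive; -0#≈0#; -‿+-comm; -1*x≈-x)
  open import Algebra.Properties.Semiring.Mult.TCOptimised semiring using (×-homo-+; ×1-homo-*; 1+×) renaming (_×_ to _×′_)
  open import Relation.Binary.Reasoning.Setoid setoid

  fromℕ : ℕ → Carrier
  fromℕ n = n ×′ 1#

  fromℤ : ℤ → Carrier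
  fromℤ (+ n)    = fromℕ n
  fromℤ -[1+ n ] = - fromℕ (suc n)

  fromSign : Sign → Carrier
  fromSign Sign.+ = 1#
  fromSign Sign.- = - 1#

  1+x-[1+y]≈x-y : ∀ x y → (1# + x) + - (1# + y) ≈ x + - y
  1+x-[1+y]≈x-y x y = begin
    (1# + x) + - (1# + y)    ≈⟨ +-congˡ (-‿+-comm 1# y) ⟨
    (1# + x) + (- 1# + - y)  ≈⟨ +-congʳ (+-comm 1# x) ⟩
    (x + 1#) + (- 1# + - y)  ≈⟨ +-assoc x 1# _ ⟩
    x + (1# + (- 1# + - y))  ≈⟨ +-congˡ (+-assoc 1# (- 1#) (- y)) ⟨
    x + ((1# + - 1#) + - y)  ≈⟨ +-congˡ (+-congʳ (-‿inverseʳ 1#)) ⟩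
    x + (0# + - y)           ≈⟨ +-congˡ (+-identityˡ (- y)) ⟩
    x + - y                  ∎

  fromℤ-⊖ : ∀ m n → fromℤ (m ⊖ n) ≈ fromℕ m + - fromℕ n
  fromℤ-⊖ zero    zero    = sym (trans (+-identityˡ _) -0#≈0#)
  fromℤ-⊖ zero    (suc n) = sym (+-identityˡ _)
  fromℤ-⊖ (suc m) zero    = sym (trans (+-congˡ -0#≈0#) (+-identityʳ _))
  fromℤ-⊖ (suc m) (suc n) rewrite ℤ.[1+m]⊖[1+n]≡m⊖n m n =
    trans (fromℤ-⊖ m n) (sym (trans (+-cong (1+× m 1#) (-‿cong (1+× n 1#))) (1+x-[1+y]≈x-y (fromℕ m) (fromℕ n))))

  fromℤ-+ : ∀ i j → fromℤ (i ℤ.+ j) ≈ fromℤ i + fromℤ j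
  fromℤ-+ (+ m)    (+ n)    = ×-homo-+ 1# m n
  fromℤ-+ (+ m)    -[1+ n ] = fromℤ-⊖ m (suc n)
  fromℤ-+ -[1+ m ] (+ n)    = trans (fromℤ-⊖ n (suc m)) (+-comm _ _)
  fromℤ-+ -[1+ m ] -[1+ n ] = begin
    - fromℕ (suc (suc (m ℕ.+ n)))      ≡⟨ ≡.cong (λ k → - fromℕ (suc k)) (ℕ.+-suc m n) ⟨
    - fromℕ (suc m ℕ.+ suc n)          ≈⟨ -‿cong (×-homo-+ 1# (suc m) (suc n)) ⟩
    - (fromℕ (suc m) + fromℕ (suc n))  ≈⟨ -‿+-comm _ _ ⟨
    - fromℕ (suc m) + - fromℕ (suc n)  ∎

  fromSign-* : ∀ s t → fromSign (s Sign.* t) ≈ fromSign s * fromSign t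
  fromSign-* Sign.+ t      = sym (*-identityˡ _)
  fromSign-* Sign.- Sign.+ = sym (*-identityʳ _)
  fromSign-* Sign.- Sign.- = sym (trans (-1*x≈-x _) (-‿involutive _))

  fromℤ-◃ : ∀ s n → fromℤ (s ◃ n) ≈ fromSign s * fromℕ n
  fromℤ-◃ s      zero    = sym (zeroʳ _)
  fromℤ-◃ Sign.+ (suc n) = sym (*-identityˡ _)
  fromℤ-◃ Sign.- (suc n) = sym (-1*x≈-x _)

  fromℤ-sign-abs : ∀ i → fromℤ i ≈ fromSign (sign i) * fromℕ ∣ i ∣
  fromℤ-sign-abs i = trans (≡.subst (λ j → fromℤ i ≈ fromℤ j) (≡.sym (ℤ.◃-inverse i)) refl)
                           (fromℤ-◃ (sign i) ∣ i ∣)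

  fromℤ-* : ∀ i j → fromℤ (i ℤ.* j) ≈ fromℤ i * fromℤ j
  fromℤ-* i j = begin
    fromℤ (sign i Sign.* sign j ◃ ∣ i ∣ ℕ.* ∣ j ∣)                  ≈⟨ fromℤ-◃ (sign i Sign.* sign j) (∣ i ∣ ℕ.* ∣ j ∣) ⟩
    fromSign (sign i Sign.* sign j) * fromℕ (∣ i ∣ ℕ.* ∣ j ∣)        ≈⟨ *-cong (fromSign-* (sign i) (sign j)) (×1-homo-* ∣ i ∣ ∣ j ∣) ⟩
    (fromSign (sign i) * fromSign (sign j)) * (fromℕ ∣ i ∣ * fromℕ ∣ j ∣) ≈⟨ interchange _ _ _ _ ⟩
    (fromSign (sign i) * fromℕ ∣ i ∣) * (fromSign (sign j) * fromℕ ∣ j ∣) ≈⟨ *-cong (fromℤ-sign-abs i) (fromℤ-sign-abs j) ⟨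
    fromℤ i * fromℤ j                                                ∎
    where open import Algebra.Properties.CommutativeSemigroup *-commutativeSemigroup using (interchange)

  fromℤ-- : ∀ i → fromℤ (ℤ.- i) ≈ - fromℤ i
  fromℤ-- (+ zero)  = sym -0#≈0#
  fromℤ-- (+ suc n) = refl
  fromℤ-- -[1+ n ]  = sym (-‿involutive _)

  homomorphism : ℤ.+-*-rawRing -Raw-AlmostCommutative⟶ fromCommutativeRing R
  homomorphism = record
    { ⟦_⟧ = fromℤ ; +-homo = fromℤ-+ ; *-homo = fromℤ-* ; -‿homo = fromℤ--
    ; 0-homo = refl ; 1-homo = refl }

  coefficient≟ : ∀ i j → Maybe (fromℤ i ≈ fromℤ j)
  coefficient≟ i j with i ℤ.≟ j
  ... | yes ≡.refl = just refl
  ... | no _       = nothing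

  open import Algebra.Solver.Ring ℤ.+-*-rawRing (fromCommutativeRing R) homomorphism coefficient≟ public

module Domain (R : CommutativeRing 0ℓ 0ℓ) (dom : IsDomain R) where
  open CommutativeRing R
  open IntegerCoefficients R using (solve; _:*_; _:-_; _:=_)
  open import Relation.Binary.Reasoning.Setoid setoid
  open import Algebra.Properties.Group +-group using (x∙y⁻¹≈ε⇒x≈y)

  ax≈0⇒x≈0 : ∀ {a x} → ¬ a ≈ 0# → a * x ≈ 0# → x ≈ 0#
  ax≈0⇒x≈0 {a} {x} a≉0 ax≈0 with proj₂ dom a x ax≈0
  ... | inj₁ a≈0 = contradiction a≈0 a≉0
  ... | inj₂ x≈0 = x≈0

  *-cancelˡ : ∀ {a x y} → ¬ a ≈ 0# → a * x ≈ a * y → x ≈ y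
  *-cancelˡ {a} {x} {y} a≉0 ax≈ay = x∙y⁻¹≈ε⇒x≈y x y (ax≈0⇒x≈0 a≉0 (begin
    a * (x - y)         ≈⟨ solve 3 (λ a x y → a :* (x :- y) := a :* x :- a :* y) refl a x y ⟩
    a * x - a * y       ≈⟨ +-congʳ ax≈ay ⟩
    a * y - a * y       ≈⟨ -‿inverseʳ (a * y) ⟩
    0#                  ∎))

module AtMaximalIdeal (R : CommutativeRing 0ℓ 0ℓ) (dom : IsDomain R)
                      (m : CommutativeRing.Carrier R → Set) (mmax : IsMaximal R m) where
  open CommutativeRing R
  open IsMaximal mmax
  open IsIdeal ideal
  open Domain R dom
  open Loc R m
  open IntegerCoefficients R using (solve; _:+_; _:*_; _:-_; :-_; _:=_; con)
  open import Algebra.Properties.Group +-group using (x∙y⁻¹≈ε⇒x≈y; x≈y⇒x∙y⁻¹≈ε)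
  open import Relation.Binary.Reasoning.Setoid setoid

  m-*ʳ : ∀ {x} r → m x → m (x * r)
  m-*ʳ {x} r x∈m = resp (*-comm r x) (mul∈ r x∈m)

  m+Rx : Carrier → Carrier → Set
  m+Rx x z = Σ Carrier λ p → Σ Carrier λ q → m p × z ≈ p + x * q

  m+Rx-isIdeal : ∀ x → IsIdeal R (m+Rx x)
  m+Rx-isIdeal x = record
    { resp  = λ { z≈z′ (p , q , p∈m , z≈) → p , q , p∈m , trans (sym z≈z′) z≈ }
    ; zero∈ = 0# , 0# , zero∈ , solve 1 (λ x → con (+ 0) := con (+ 0) :+ x :* con (+ 0)) refl x
    ; add∈  = λ { (p , q , p∈m , z≈) (p′ , q′ , p′∈m , z′≈) → p + p′ , q + q′ , add∈ p∈m p′∈m ,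
                  trans (+-cong z≈ z′≈) (solve 5 (λ p q p′ q′ x → (p :+ x :* q) :+ (p′ :+ x :* q′)
                                                   := (p :+ p′) :+ x :* (q :+ q′)) refl p q p′ q′ x) }
    ; mul∈  = λ { r (p , q , p∈m , z≈) → r * p , r * q , mul∈ r p∈m ,
                  trans (*-congˡ z≈) (solve 4 (λ r p q x → r :* (p :+ x :* q) := r :* p :+ x :* (r :* q)) refl r p q x) }
    }

  x∈m+Rx : ∀ x → m+Rx x x
  x∈m+Rx x = 0# , 1# , zero∈ , solve 1 (λ x → x := con (+ 0) :+ x :* con (+ 1)) refl x

  m⊆m+Rx : ∀ x z → m z → m+Rx x z
  m⊆m+Rx x z z∈m = z , 0# , z∈m , solve 2 (λ z x → z := z :+ x :* con (+ 0)) refl z x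

  1∈m+Rx⇒∉m : ∀ {x} → m+Rx x 1# → ¬ m x
  1∈m+Rx⇒∉m (p , q , p∈m , 1≈) x∈m = proper (resp (sym 1≈) (add∈ p∈m (m-*ʳ q x∈m)))

  -- Maximality, as stated with a disjunction, makes membership in m decidable.
  m? : ∀ x → Dec (m x)
  m? x with max (m+Rx x) (m+Rx-isIdeal x) (m⊆m+Rx x)
  ... | inj₁ m+Rx⊆m = yes (m+Rx⊆m x (x∈m+Rx x))
  ... | inj₂ 1∈m+Rx = no (1∈m+Rx⇒∉m 1∈m+Rx)

  ∉m⇒1∈m+Rx : ∀ {x} → ¬ m x → m+Rx x 1#
  ∉m⇒1∈m+Rx {x} x∉m with max (m+Rx x) (m+Rx-isIdeal x) (m⊆m+Rx x)
  ... | inj₁ m+Rx⊆m = contradiction (m+Rx⊆m x (x∈m+Rx x)) x∉m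
  ... | inj₂ 1∈m+Rx = 1∈m+Rx

  m-stable : ∀ {x} → ¬ ¬ m x → m x
  m-stable {x} = decidable-stable (m? x)

  m-prime : ∀ {x y} → m (x * y) → ¬ m x → m y
  m-prime {x} {y} xy∈m x∉m with ∉m⇒1∈m+Rx x∉m
  ... | p , q , p∈m , 1≈ = resp (sym y≈) (add∈ (mul∈ y p∈m) (m-*ʳ q xy∈m))
    where
    y≈ : y ≈ y * p + (x * y) * q
    y≈ = begin
      y                        ≈⟨ *-identityʳ y ⟨
      y * 1#                   ≈⟨ *-congˡ 1≈ ⟩
      y * (p + x * q)          ≈⟨ solve 4 (λ y p x q → y :* (p :+ x :* q) := y :* p :+ (x :* y) :* q) refl y p x q ⟩
      y * p + (x * y) * q      ∎

  ∉m-* : ∀ {x y} → ¬ m x → ¬ m y → ¬ m (x * y)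
  ∉m-* x∉m y∉m xy∈m = y∉m (m-prime xy∈m x∉m)

  ∉m⇒≉0 : ∀ {x} → ¬ m x → ¬ x ≈ 0#
  ∉m⇒≉0 x∉m x≈0 = x∉m (resp (sym x≈0) zero∈)

  prodD-∉m : ∀ S → ¬ m (prodD S)
  prodD-∉m []      = proper
  prodD-∉m (s ∷ S) = ∉m-* (proj₂ s) (prodD-∉m S)

  prodD-++ : ∀ S S′ → prodD (S ++ S′) ≈ prodD S * prodD S′
  prodD-++ []      S′ = sym (*-identityˡ _)
  prodD-++ (s ∷ S) S′ = trans (*-congˡ (prodD-++ S S′)) (sym (*-assoc _ _ _))

  ~⇒cross : ∀ {r S r′ S′} → (r , S) ~ (r′ , S′) → r * prodD S′ ≈ r′ * prodD S
  ~⇒cross (T , T[rS′-r′S]≈0) = x∙y⁻¹≈ε⇒x≈y _ _ (ax≈0⇒x≈0 (∉m⇒≉0 (prodD-∉m T)) T[rS′-r′S]≈0)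

  cross⇒~ : ∀ {r S r′ S′} → r * prodD S′ ≈ r′ * prodD S → (r , S) ~ (r′ , S′)
  cross⇒~ rS′≈r′S = [] , trans (*-identityˡ _) (x≈y⇒x∙y⁻¹≈ε rS′≈r′S)

  -- a ≼ b says that a divides b in R_m, i.e. v(a) ≤ v(b) for the valuation of R_m;
  -- a ≺ b says moreover that the quotient lies in m, i.e. v(a) < v(b).
  -- no-eta-equality keeps type checking from unfolding these witnesses into the solver proofs
  -- that produce them.
  record _≼_ (a b : Carrier) : Set where
    no-eta-equality
    pattern
    constructor divides
    field
      s u : Carrier
      s∉m : ¬ m s
      eq  : s * b ≈ a * u

  record _≺_ (a b : Carrier) : Set where
    no-eta-equality
    pattern
    constructor dividesProperly
    field
      s u : Carrier
      s∉m : ¬ m s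
      u∈m : m u
      eq  : s * b ≈ a * u

  infix 4 _≼_ _≺_ _≈ᵥ_

  _≈ᵥ_ : Carrier → Carrier → Set
  a ≈ᵥ b = a ≼ b × b ≼ a

  ≺⇒≼ : ∀ {a b} → a ≺ b → a ≼ b
  ≺⇒≼ (dividesProperly s u s∉m _ eq) = divides s u s∉m eq

  ≼-refl : ∀ a → a ≼ a
  ≼-refl a = divides 1# 1# proper (*-comm 1# a)

  ≼-flip : ∀ {a b s u} → ¬ m u → s * b ≈ a * u → b ≼ a
  ≼-flip {a} {b} {s} {u} u∉m eq = divides u s u∉m (trans (*-comm u a) (trans (sym eq) (*-comm s b)))

  private
    compose : ∀ {a b c s u s′ u′} → s * b ≈ a * u → s′ * c ≈ b * u′ → (s * s′) * c ≈ a * (u * u′)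
    compose {a} {b} {c} {s} {u} {s′} {u′} eq eq′ = begin
      (s * s′) * c   ≈⟨ *-assoc s s′ c ⟩
      s * (s′ * c)   ≈⟨ *-congˡ eq′ ⟩
      s * (b * u′)   ≈⟨ *-assoc s b u′ ⟨
      (s * b) * u′   ≈⟨ *-congʳ eq ⟩
      (a * u) * u′   ≈⟨ *-assoc a u u′ ⟩
      a * (u * u′)   ∎

  ≼-trans : ∀ {a b c} → a ≼ b → b ≼ c → a ≼ c
  ≼-trans (divides s u s∉m eq) (divides s′ u′ s′∉m eq′) =
    divides (s * s′) (u * u′) (∉m-* s∉m s′∉m) (compose eq eq′)

  ≼-≺-trans : ∀ {a b c} → a ≼ b → b ≺ c → a ≺ c
  ≼-≺-trans (divides s u s∉m eq) (dividesProperly s′ u′ s′∉m u′∈m eq′) =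
    dividesProperly (s * s′) (u * u′) (∉m-* s∉m s′∉m) (mul∈ u u′∈m) (compose eq eq′)

  ≺-≼-trans : ∀ {a b c} → a ≺ b → b ≼ c → a ≺ c
  ≺-≼-trans (dividesProperly s u s∉m u∈m eq) (divides s′ u′ s′∉m eq′) =
    dividesProperly (s * s′) (u * u′) (∉m-* s∉m s′∉m) (m-*ʳ u′ u∈m) (compose eq eq′)

  ≼-resp-≈ : ∀ {a a′ b b′} → a ≈ a′ → b ≈ b′ → a ≼ b → a′ ≼ b′
  ≼-resp-≈ a≈a′ b≈b′ (divides s u s∉m eq) =
    divides s u s∉m (trans (*-congˡ (sym b≈b′)) (trans eq (*-congʳ a≈a′)))

  ≺-resp-≈ : ∀ {a a′ b b′} → a ≈ a′ → b ≈ b′ → a ≺ b → a′ ≺ b′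
  ≺-resp-≈ a≈a′ b≈b′ (dividesProperly s u s∉m u∈m eq) =
    dividesProperly s u s∉m u∈m (trans (*-congˡ (sym b≈b′)) (trans eq (*-congʳ a≈a′)))

  a≼a*b : ∀ a b → a ≼ a * b
  a≼a*b a b = divides 1# b proper (*-identityˡ _)

  a≺a*b : ∀ a {b} → m b → a ≺ a * b
  a≺a*b a {b} b∈m = dividesProperly 1# b proper b∈m (*-identityˡ _)

  ≼-0 : ∀ a → a ≼ 0#
  ≼-0 a = divides 1# 0# proper (trans (zeroʳ 1#) (sym (zeroʳ a)))

  ≺-0 : ∀ a → a ≺ 0#
  ≺-0 a = dividesProperly 1# 0# proper zero∈ (trans (zeroʳ 1#) (sym (zeroʳ a)))

  ∉m⇒≼ : ∀ {a} b → ¬ m a → a ≼ b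
  ∉m⇒≼ {a} b a∉m = divides a b a∉m refl

  ∉m⇒≺ : ∀ {a b} → ¬ m a → m b → a ≺ b
  ∉m⇒≺ {a} {b} a∉m b∈m = dividesProperly a b a∉m b∈m refl

  1≺ : ∀ {a} → m a → 1# ≺ a
  1≺ {a} a∈m = ∉m⇒≺ proper a∈m

  ≺⇒∈m : ∀ {a b} → a ≺ b → m b
  ≺⇒∈m {a} {b} (dividesProperly s u s∉m u∈m eq) = m-prime (resp (sym eq) (mul∈ a u∈m)) s∉m

  ≼-∈m : ∀ {a b} → m a → a ≼ b → m b
  ≼-∈m {a} {b} a∈m (divides s u s∉m eq) = m-prime (resp (sym eq) (m-*ʳ u a∈m)) s∉m

  private
    scale : ∀ {a b s u} k → s * b ≈ a * u → s * (k * b) ≈ (k * a) * u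
    scale {a} {b} {s} {u} k eq = begin
      s * (k * b)   ≈⟨ solve 3 (λ s k b → s :* (k :* b) := k :* (s :* b)) refl s k b ⟩
      k * (s * b)   ≈⟨ *-congˡ eq ⟩
      k * (a * u)   ≈⟨ *-assoc k a u ⟨
      (k * a) * u   ∎

    extend : ∀ {a b s u} k → s * b ≈ a * u → s * (b * k) ≈ a * (u * k)
    extend {a} {b} {s} {u} k eq = begin
      s * (b * k)   ≈⟨ *-assoc s b k ⟨
      (s * b) * k   ≈⟨ *-congʳ eq ⟩
      (a * u) * k   ≈⟨ *-assoc a u k ⟩
      a * (u * k)   ∎

    absorb : ∀ {a b t s u} → s * (b * t) ≈ a * u → (s * t) * b ≈ a * u
    absorb {a} {b} {t} {s} {u} eq = trans (solve 3 (λ s t b → (s :* t) :* b := s :* (b :* t)) refl s t b) eq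

    add : ∀ {a b c s u s′ u′} → s * b ≈ a * u → s′ * c ≈ a * u′ → (s * s′) * (b + c) ≈ a * (s′ * u + s * u′)
    add {a} {b} {c} {s} {u} {s′} {u′} eq eq′ = begin
      (s * s′) * (b + c)            ≈⟨ solve 4 (λ s s′ b c → (s :* s′) :* (b :+ c) := s′ :* (s :* b) :+ s :* (s′ :* c)) refl s s′ b c ⟩
      s′ * (s * b) + s * (s′ * c)   ≈⟨ +-cong (*-congˡ eq) (*-congˡ eq′) ⟩
      s′ * (a * u) + s * (a * u′)   ≈⟨ solve 5 (λ s′ a u s u′ → s′ :* (a :* u) :+ s :* (a :* u′) := a :* (s′ :* u :+ s :* u′))
                                             refl s′ a u s u′ ⟩
      a * (s′ * u + s * u′)         ∎

  ≼-*-monoˡ : ∀ {a b} k → a ≼ b → k * a ≼ k * b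
  ≼-*-monoˡ k (divides s u s∉m eq) = divides s u s∉m (scale k eq)

  ≺-*-monoˡ : ∀ {a b} k → a ≺ b → k * a ≺ k * b
  ≺-*-monoˡ k (dividesProperly s u s∉m u∈m eq) = dividesProperly s u s∉m u∈m (scale k eq)

  ≼-*ʳ : ∀ {a b} k → a ≼ b → a ≼ b * k
  ≼-*ʳ k (divides s u s∉m eq) = divides s (u * k) s∉m (extend k eq)

  ≺-*ʳ : ∀ {a b} k → a ≺ b → a ≺ b * k
  ≺-*ʳ k (dividesProperly s u s∉m u∈m eq) = dividesProperly s (u * k) s∉m (m-*ʳ k u∈m) (extend k eq)

  ≼-cancel-∉m : ∀ {a b t} → ¬ m t → a ≼ b * t → a ≼ b
  ≼-cancel-∉m t∉m (divides s u s∉m eq) = divides _ u (∉m-* s∉m t∉m) (absorb eq)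

  ≺-cancel-∉m : ∀ {a b t} → ¬ m t → a ≺ b * t → a ≺ b
  ≺-cancel-∉m t∉m (dividesProperly s u s∉m u∈m eq) = dividesProperly _ u (∉m-* s∉m t∉m) u∈m (absorb eq)

  ≼-+ : ∀ {a b c} → a ≼ b → a ≼ c → a ≼ b + c
  ≼-+ (divides s u s∉m eq) (divides s′ u′ s′∉m eq′) = divides (s * s′) _ (∉m-* s∉m s′∉m) (add eq eq′)

  ≺-+ : ∀ {a b c} → a ≺ b → a ≺ c → a ≺ b + c
  ≺-+ (dividesProperly s u s∉m u∈m eq) (dividesProperly s′ u′ s′∉m u′∈m eq′) =
    dividesProperly (s * s′) _ (∉m-* s∉m s′∉m) (add∈ (mul∈ s′ u∈m) (mul∈ s u′∈m)) (add eq eq′)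

  private
    unscale : ∀ {a b s u k} → ¬ k ≈ 0# → s * (k * b) ≈ (k * a) * u → s * b ≈ a * u
    unscale {a} {b} {s} {u} {k} k≉0 eq = *-cancelˡ k≉0 (begin
      k * (s * b)   ≈⟨ solve 3 (λ k s b → k :* (s :* b) := s :* (k :* b)) refl k s b ⟩
      s * (k * b)   ≈⟨ eq ⟩
      (k * a) * u   ≈⟨ *-assoc k a u ⟩
      k * (a * u)   ∎)

  ≼-*-cancelˡ : ∀ {k a b} → ¬ k ≈ 0# → k * a ≼ k * b → a ≼ b
  ≼-*-cancelˡ k≉0 (divides s u s∉m eq) = divides s u s∉m (unscale k≉0 eq)

  ≺-*-cancelˡ : ∀ {k a b} → ¬ k ≈ 0# → k * a ≺ k * b → a ≺ b
  ≺-*-cancelˡ k≉0 (dividesProperly s u s∉m u∈m eq) = dividesProperly s u s∉m u∈m (unscale k≉0 eq)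

  ≼-≉0 : ∀ {a b} → b ≼ a → ¬ a ≈ 0# → ¬ b ≈ 0#
  ≼-≉0 {a} {b} (divides s u s∉m eq) a≉0 b≈0 = ∉m⇒≉0 s∉m (ax≈0⇒x≈0 a≉0 (begin
    a * s   ≈⟨ *-comm a s ⟩
    s * a   ≈⟨ eq ⟩
    b * u   ≈⟨ *-congʳ b≈0 ⟩
    0# * u  ≈⟨ zeroˡ u ⟩
    0#      ∎))

  ≺-≉0 : ∀ {a b} → a ≺ b → ¬ b ≈ 0# → ¬ a ≈ 0#
  ≺-≉0 a≺b = ≼-≉0 (≺⇒≼ a≺b)

  ≺-asym : ∀ {a b} → a ≺ b → b ≼ a → ¬ b ≈ 0# → ⊥
  ≺-asym {a} {b} (dividesProperly s u s∉m u∈m eq) (divides s′ u′ s′∉m eq′) b≉0 =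
    ∉m-* s′∉m s∉m (resp (sym (*-cancelˡ b≉0 b[s′s]≈b[u′u])) (mul∈ u′ u∈m))
    where
    b[s′s]≈b[u′u] : b * (s′ * s) ≈ b * (u′ * u)
    b[s′s]≈b[u′u] = begin
      b * (s′ * s)    ≈⟨ solve 3 (λ b s′ s → b :* (s′ :* s) := s′ :* (s :* b)) refl b s′ s ⟩
      s′ * (s * b)    ≈⟨ *-congˡ eq ⟩
      s′ * (a * u)    ≈⟨ *-assoc s′ a u ⟨
      (s′ * a) * u    ≈⟨ *-congʳ eq′ ⟩
      (b * u′) * u    ≈⟨ *-assoc b u′ u ⟩
      b * (u′ * u)    ∎

  ≺-irrefl : ∀ {a} → a ≺ a → ¬ a ≈ 0# → ⊥
  ≺-irrefl {a} a≺a = ≺-asym a≺a (≼-refl a)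

  ι∣ι⇒≼ : ∀ {a b} → ι a ∣L ι b → a ≼ b
  ι∣ι⇒≼ {a} {b} ((u , U) , b~au) =
    divides (prodD U) u (prodD-∉m U) (trans (*-comm _ _) (trans (~⇒cross {b} {[]} {a * u} {U} b~au) (*-identityʳ _)))

  ≼⇒ι∣ι : ∀ {a b} → a ≼ b → ι a ∣L ι b
  ≼⇒ι∣ι {a} {b} (divides s u s∉m eq) = (u , (s , s∉m) ∷ []) , cross⇒~ {b} {[]} {a * u} {(s , s∉m) ∷ []} (begin
    b * (s * 1#)   ≈⟨ solve 2 (λ b s → b :* (s :* con (+ 1)) := s :* b) refl b s ⟩
    s * b          ≈⟨ eq ⟩
    a * u          ≈⟨ *-identityʳ (a * u) ⟨
    (a * u) * 1#   ∎)

  ≈ᵥ⇒SamePrincipal : ∀ {a b} → a ≈ᵥ b → SamePrincipal (ι a) (ι b)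
  ≈ᵥ⇒SamePrincipal (a≼b , b≼a) = ≼⇒ι∣ι a≼b , ≼⇒ι∣ι b≼a

  SamePrincipal⇒≈ᵥ : ∀ {a b} → SamePrincipal (ι a) (ι b) → a ≈ᵥ b
  SamePrincipal⇒≈ᵥ (a∣b , b∣a) = ι∣ι⇒≼ a∣b , ι∣ι⇒≼ b∣a

  InmRm-ι⇒∈m : ∀ {a} → InmRm (ι a) → m a
  InmRm-ι⇒∈m {a} (r , S , r∈m , a~r/S) =
    m-prime (resp (trans (sym (trans (~⇒cross {a} {[]} {r} {S} a~r/S) (*-identityʳ r))) (*-comm a (prodD S))) r∈m)
            (prodD-∉m S)

  ∈m⇒InmRm-ι : ∀ {a} → m a → InmRm (ι a)
  ∈m⇒InmRm-ι {a} a∈m = a , [] , a∈m , cross⇒~ {a} {[]} {a} {[]} refl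

  module _ (valuation : IsValuation) where

    ≼-total : ∀ a b → a ≼ b ⊎ b ≼ a
    ≼-total a b with valuation (ι a) (ι b)
    ... | inj₁ a∣b = inj₁ (ι∣ι⇒≼ a∣b)
    ... | inj₂ b∣a = inj₂ (ι∣ι⇒≼ b∣a)

    data Compare (a b : Carrier) : Set where
      less    : a ≺ b → Compare a b
      equiv   : a ≈ᵥ b → Compare a b
      greater : b ≺ a → Compare a b

    compare : ∀ a b → Compare a b
    compare a b with ≼-total a b
    ... | inj₁ (divides s u s∉m eq) with m? u
    ...   | yes u∈m = less (dividesProperly s u s∉m u∈m eq)
    ...   | no  u∉m = equiv (divides s u s∉m eq , ≼-flip u∉m eq)
    compare a b | inj₂ (divides s u s∉m eq) with m? u
    ...   | yes u∈m = greater (dividesProperly s u s∉m u∈m eq)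
    ...   | no  u∉m = equiv (≼-flip u∉m eq , divides s u s∉m eq)

    ≼-or-≻ : ∀ a b → a ≼ b ⊎ b ≺ a
    ≼-or-≻ a b with compare a b
    ... | less a≺b        = inj₁ (≺⇒≼ a≺b)
    ... | equiv (a≼b , _) = inj₁ a≼b
    ... | greater b≺a     = inj₂ b≺a

    ⋠⇒≻ : ∀ {a b} → ¬ a ≼ b → b ≺ a
    ⋠⇒≻ {a} {b} a⋠b with ≼-or-≻ a b
    ... | inj₁ a≼b = contradiction a≼b a⋠b
    ... | inj₂ b≺a = b≺a

  nonunit⇒∈m : ∀ e E → ¬ IsUnit (e , E) → m e
  nonunit⇒∈m e E nonunit = m-stable λ e∉m → nonunit ((prodD E , (e , e∉m) ∷ []) ,
    cross⇒~ {1#} {[]} {e * prodD E} {E ++ (e , e∉m) ∷ []} (begin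
      1# * prodD (E ++ (e , e∉m) ∷ [])  ≈⟨ *-congˡ (prodD-++ E ((e , e∉m) ∷ [])) ⟩
      1# * (prodD E * (e * 1#))          ≈⟨ solve 2 (λ p e → con (+ 1) :* (p :* (e :* con (+ 1))) := (e :* p) :* con (+ 1)) refl (prodD E) e ⟩
      (e * prodD E) * 1#                 ∎))

  module _ (dense : DenseValueGroup) where

    ∈m⇒product-of-∈m : ∀ {u} → ¬ u ≈ 0# → m u →
      Σ Carrier λ e → Σ Carrier λ f → Σ Carrier λ t → m e × m f × ¬ m t × t * u ≈ e * f
    ∈m⇒product-of-∈m {u} u≉0 u∈m with dense (ι u) ι-u≉0 ι-u-nonunit
      where
      ι-u≉0 : ¬ ι u ~ 0F
      ι-u≉0 u~0 = u≉0 (trans (sym (*-identityʳ u)) (trans (~⇒cross {u} {[]} {0#} {[]} u~0) (zeroˡ _)))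
      ι-u-nonunit : ¬ IsUnit (ι u)
      ι-u-nonunit ((w , W) , 1~uw) = prodD-∉m W (resp (sym W≈uw) (m-*ʳ 1# (m-*ʳ w u∈m)))
        where
        W≈uw : prodD W ≈ (u * w) * 1#
        W≈uw = trans (sym (*-identityˡ _)) (~⇒cross {1#} {[]} {u * w} {W} 1~uw)
    ... | (e , E) , (f , F) , _ , e/E-nonunit , f/F-nonunit , u~ef =
      e , f , prodD (E ++ F) , nonunit⇒∈m e E e/E-nonunit , nonunit⇒∈m f F f/F-nonunit , prodD-∉m (E ++ F) ,
      trans (*-comm _ _) (trans (~⇒cross {u} {[]} {e * f} {E ++ F} u~ef) (*-identityʳ _))

    ≺-factor : ∀ {a b} → a ≺ b → ¬ b ≈ 0# → Σ Carrier λ e → Σ Carrier λ f → m e × m f × (a * e) * f ≈ᵥ b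
    ≺-factor {a} {b} (dividesProperly s u s∉m u∈m eq) b≉0 = factor (∈m⇒product-of-∈m u≉0 u∈m)
      where
      u≉0 : ¬ u ≈ 0#
      u≉0 u≈0 = b≉0 (ax≈0⇒x≈0 (∉m⇒≉0 s∉m) (trans eq (trans (*-congˡ u≈0) (zeroʳ a))))
      factor : (Σ Carrier λ e → Σ Carrier λ f → Σ Carrier λ t → m e × m f × ¬ m t × t * u ≈ e * f) →
               Σ Carrier λ e → Σ Carrier λ f → m e × m f × (a * e) * f ≈ᵥ b
      factor (e , f , t , e∈m , f∈m , t∉m , tu≈ef) =
        e , f , e∈m , f∈m , divides (t * s) 1# (∉m-* t∉m s∉m) ts·b≈aef·1 , ≼-flip proper ts·b≈aef·1
        where
        ts·b≈aef·1 : (t * s) * b ≈ ((a * e) * f) * 1#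
        ts·b≈aef·1 = begin
          (t * s) * b          ≈⟨ *-assoc t s b ⟩
          t * (s * b)          ≈⟨ *-congˡ eq ⟩
          t * (a * u)          ≈⟨ solve 3 (λ t a u → t :* (a :* u) := a :* (t :* u)) refl t a u ⟩
          a * (t * u)          ≈⟨ *-congˡ tu≈ef ⟩
          a * (e * f)          ≈⟨ *-assoc a e f ⟨
          (a * e) * f          ≈⟨ *-identityʳ _ ⟨
          ((a * e) * f) * 1#   ∎

    ≺-dense : ∀ {a b} → a ≺ b → ¬ b ≈ 0# → Σ Carrier λ c → a ≺ c × c ≺ b
    ≺-dense {a} a≺b b≉0 = let e , f , e∈m , f∈m , aef≼b , _ = ≺-factor a≺b b≉0 in
      a * e , a≺a*b a e∈m , ≺-≼-trans (a≺a*b (a * e) f∈m) aef≼b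

  record SaturatedIdeal (P : Carrier → Set) : Set where
    field
      P-resp      : ∀ {x y} → x ≈ y → P x → P y
      P-0         : P 0#
      P-+         : ∀ {x y} → P x → P y → P (x + y)
      P-*         : ∀ k {x} → P x → P (k * x)
      P-saturated : ∀ {k x} → ¬ m k → P (k * x) → P x

  -- The modules of the theorem are fractions modulo a submodule of R_m whose trace on R is a
  -- saturated ideal P: γ m R_m ∩ R = {x | γ ≺ x} and δ R_m ∩ R = {x | δ ≼ x}.
  record FractionPresentation (N : PPStr Carrier) : Set₁ where
    open PPStr N
    field
      P       : Carrier → Set
      P-ideal : SaturatedIdeal P
      num den : Car → Carrier
      den∉m   : ∀ x → ¬ m (den x)
      ≈M⇒P    : ∀ {x y} → x ≈M y → P (num x * den y - num y * den x)
      P⇒≈M    : ∀ {x y} → P (num x * den y - num y * den x) → x ≈M y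
      num-+   : ∀ x y → num (x +M y) ≈ num x * den y + num y * den x
      den-+   : ∀ x y → den (x +M y) ≈ den x * den y
      num-0   : num 0M ≈ 0#
      den-0   : den 0M ≈ 1#
      num-·   : ∀ r x → num (r ·M x) ≈ r * num x
      den-·   : ∀ r x → den (r ·M x) ≈ den x

  module PresentedModule {N : PPStr Carrier} (pres : FractionPresentation N) where
    open PPStr N
    open FractionPresentation pres
    open SaturatedIdeal P-ideal

    infix 4 _↦_/_

    _↦_/_ : Car → Carrier → Carrier → Set
    x ↦ A / B = num x ≈ A × den x ≈ B

    ↦-self : ∀ x → x ↦ num x / den x
    ↦-self x = refl , refl

    ↦-+ : ∀ {x y A B C D} → x ↦ A / B → y ↦ C / D → (x +M y) ↦ A * D + C * B / B * D
    ↦-+ {x} {y} (x≈A , x≈B) (y≈C , y≈D) =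
      trans (num-+ x y) (+-cong (*-cong x≈A y≈D) (*-cong y≈C x≈B)) , trans (den-+ x y) (*-cong x≈B y≈D)

    ↦-· : ∀ {x A B} r → x ↦ A / B → (r ·M x) ↦ r * A / B
    ↦-· {x} r (x≈A , x≈B) = trans (num-· r x) (*-congˡ x≈A) , trans (den-· r x) x≈B

    ↦-0 : 0M ↦ 0# / 1#
    ↦-0 = num-0 , den-0

    cross-cong : ∀ {x y A B C D} → x ↦ A / B → y ↦ C / D → num x * den y - num y * den x ≈ A * D - C * B
    cross-cong (x≈A , x≈B) (y≈C , y≈D) = +-cong (*-cong x≈A y≈D) (-‿cong (*-cong y≈C x≈B))

    ≈M-intro : ∀ {x y A B C D X} → x ↦ A / B → y ↦ C / D → A * D - C * B ≈ X → P X → x ≈M y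
    ≈M-intro x↦ y↦ cross≈X X∈P = P⇒≈M (P-resp (sym (trans (cross-cong x↦ y↦) cross≈X)) X∈P)

    ≈M-by-cross : ∀ {x y A B C D} → x ↦ A / B → y ↦ C / D → A * D ≈ C * B → x ≈M y
    ≈M-by-cross x↦ y↦ AD≈CB = ≈M-intro x↦ y↦ (x≈y⇒x∙y⁻¹≈ε AD≈CB) P-0

    ≈M-elim : ∀ {x y A B C D} → x ↦ A / B → y ↦ C / D → x ≈M y → P (A * D - C * B)
    ≈M-elim x↦ y↦ x≈y = P-resp (cross-cong x↦ y↦) (≈M⇒P x≈y)

    ≈M-refl : ∀ x → x ≈M x
    ≈M-refl x = ≈M-by-cross (↦-self x) (↦-self x) refl

    ≈M-sym : ∀ {x y} → x ≈M y → y ≈M x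
    ≈M-sym {x} {y} x≈y = ≈M-intro (↦-self y) (↦-self x)
      (solve 4 (λ a b c d → a :* b :- c :* d := (:- con (+ 1)) :* (c :* d :- a :* b)) refl (num y) (den x) (num x) (den y))
      (P-* (- 1#) (≈M⇒P x≈y))

    -- den y is a unit of R_m, so it can be cancelled from the combination below
    ≈M-trans : ∀ {x y z} → x ≈M y → y ≈M z → x ≈M z
    ≈M-trans {x} {y} {z} x≈y y≈z =
      P⇒≈M (P-saturated (den∉m y) (P-resp combination (P-+ (P-* (den z) (≈M⇒P x≈y)) (P-* (den x) (≈M⇒P y≈z)))))
      where
      combination : den z * (num x * den y - num y * den x) + den x * (num y * den z - num z * den y)
                  ≈ den y * (num x * den z - num z * den x)
      combination = solve 6 (λ nx dx ny dy nz dz → dz :* (nx :* dy :- ny :* dx) :+ dx :* (ny :* dz :- nz :* dy)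
                                                   := dy :* (nx :* dz :- nz :* dx))
                            refl (num x) (den x) (num y) (den y) (num z) (den z)

    +M-congˡ : ∀ {x x′ y} → x ≈M x′ → (x +M y) ≈M (x′ +M y)
    +M-congˡ {x} {x′} {y} x≈x′ = ≈M-intro (↦-+ (↦-self x) (↦-self y)) (↦-+ (↦-self x′) (↦-self y))
      (solve 6 (λ nx dx nx′ dx′ ny dy → (nx :* dy :+ ny :* dx) :* (dx′ :* dy) :- (nx′ :* dy :+ ny :* dx′) :* (dx :* dy)
                                        := (dy :* dy) :* (nx :* dx′ :- nx′ :* dx))
             refl (num x) (den x) (num x′) (den x′) (num y) (den y))
      (P-* (den y * den y) (≈M⇒P x≈x′))

    +M-congʳ : ∀ {x y y′} → y ≈M y′ → (x +M y) ≈M (x +M y′)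
    +M-congʳ {x} {y} {y′} y≈y′ = ≈M-intro (↦-+ (↦-self x) (↦-self y)) (↦-+ (↦-self x) (↦-self y′))
      (solve 6 (λ nx dx ny dy ny′ dy′ → (nx :* dy :+ ny :* dx) :* (dx :* dy′) :- (nx :* dy′ :+ ny′ :* dx) :* (dx :* dy)
                                        := (dx :* dx) :* (ny :* dy′ :- ny′ :* dy))
             refl (num x) (den x) (num y) (den y) (num y′) (den y′))
      (P-* (den x * den x) (≈M⇒P y≈y′))

    ·M-congʳ : ∀ {x x′} r → x ≈M x′ → (r ·M x) ≈M (r ·M x′)
    ·M-congʳ {x} {x′} r x≈x′ = ≈M-intro (↦-· r (↦-self x)) (↦-· r (↦-self x′))
      (solve 5 (λ r nx dx nx′ dx′ → (r :* nx) :* dx′ :- (r :* nx′) :* dx := r :* (nx :* dx′ :- nx′ :* dx))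
             refl r (num x) (den x) (num x′) (den x′))
      (P-* r (≈M⇒P x≈x′))

    0+M0 : (0M +M 0M) ≈M 0M
    0+M0 = ≈M-by-cross (↦-+ ↦-0 ↦-0) ↦-0
      (solve 0 ((con (+ 0) :* con (+ 1) :+ con (+ 0) :* con (+ 1)) :* con (+ 1) := con (+ 0) :* (con (+ 1) :* con (+ 1))) refl)

    ·M-0 : ∀ r → (r ·M 0M) ≈M 0M
    ·M-0 r = ≈M-by-cross (↦-· r ↦-0) ↦-0 (solve 1 (λ r → (r :* con (+ 0)) :* con (+ 1) := con (+ 0) :* con (+ 1)) refl r)

    ·M-distrib-+M : ∀ r x y → (r ·M (x +M y)) ≈M ((r ·M x) +M (r ·M y))
    ·M-distrib-+M r x y = ≈M-by-cross (↦-· r (↦-+ (↦-self x) (↦-self y))) (↦-+ (↦-· r (↦-self x)) (↦-· r (↦-self y)))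
      (solve 5 (λ r nx dx ny dy → (r :* (nx :* dy :+ ny :* dx)) :* (dx :* dy) := ((r :* nx) :* dy :+ (r :* ny) :* dx) :* (dx :* dy))
             refl r (num x) (den x) (num y) (den y))

    ·M-comm : ∀ a r x → (a ·M (r ·M x)) ≈M (r ·M (a ·M x))
    ·M-comm a r x = ≈M-by-cross (↦-· a (↦-· r (↦-self x))) (↦-· r (↦-· a (↦-self x)))
      (solve 4 (λ a r nx dx → (a :* (r :* nx)) :* dx := (r :* (a :* nx)) :* dx) refl a r (num x) (den x))

    +M-interchange : ∀ a b c d → ((a +M b) +M (c +M d)) ≈M ((a +M c) +M (b +M d))
    +M-interchange a b c d =
      ≈M-by-cross (↦-+ (↦-+ (↦-self a) (↦-self b)) (↦-+ (↦-self c) (↦-self d)))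
                  (↦-+ (↦-+ (↦-self a) (↦-self c)) (↦-+ (↦-self b) (↦-self d)))
      (solve 8 (λ na da nb db nc dc nd dd →
               ((na :* db :+ nb :* da) :* (dc :* dd) :+ (nc :* dd :+ nd :* dc) :* (da :* db)) :* ((da :* dc) :* (db :* dd))
            := ((na :* dc :+ nc :* da) :* (db :* dd) :+ (nb :* dd :+ nd :* db) :* (da :* dc)) :* ((da :* db) :* (dc :* dd)))
             refl (num a) (den a) (num b) (den b) (num c) (den c) (num d) (den d))

    ≈M-·M-+M : ∀ r x y → y ≈M ((r ·M x) +M (y +M ((- r) ·M x)))
    ≈M-·M-+M r x y = ≈M-by-cross (↦-self y) (↦-+ (↦-· r (↦-self x)) (↦-+ (↦-self y) (↦-· (- r) (↦-self x))))
      (solve 5 (λ r nx dx ny dy → ny :* (dx :* (dy :* dx)) := ((r :* nx) :* (dy :* dx) :+ (ny :* dx :+ ((:- r) :* nx) :* dy) :* dx) :* dy)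
             refl r (num x) (den x) (num y) (den y))

    ⟦_⟧ᴺ : PP R → Car → Set
    ⟦ θ ⟧ᴺ = ⟦_⟧ R N θ

    sumM-cong : ∀ {n} {f g : Fin n → Car} → (∀ j → f j ≈M g j) → sumM R N f ≈M sumM R N g
    sumM-cong {zero}  f≈g = ≈M-refl 0M
    sumM-cong {suc n} f≈g = ≈M-trans (+M-congˡ (f≈g fzero)) (+M-congʳ (sumM-cong (λ j → f≈g (fsuc j))))

    sumM-+ : ∀ {n} (f g : Fin n → Car) → sumM R N (λ j → f j +M g j) ≈M (sumM R N f +M sumM R N g)
    sumM-+ {zero}  f g = ≈M-sym 0+M0
    sumM-+ {suc n} f g = ≈M-trans (+M-congʳ (sumM-+ (λ j → f (fsuc j)) (λ j → g (fsuc j)))) (+M-interchange _ _ _ _)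

    sumM-· : ∀ {n} r (f : Fin n → Car) → sumM R N (λ j → r ·M f j) ≈M (r ·M sumM R N f)
    sumM-· {zero}  r f = ≈M-sym (·M-0 r)
    sumM-· {suc n} r f = ≈M-trans (+M-congʳ (sumM-· r (λ j → f (fsuc j)))) (≈M-sym (·M-distrib-+M r _ _))

    ⟦⟧-resp : ∀ θ {x x′} → x ≈M x′ → ⟦ θ ⟧ᴺ x → ⟦ θ ⟧ᴺ x′
    ⟦⟧-resp (pp k l a) {x} {x′} x≈x′ (ys , eqs) = ys , λ i → ≈M-trans (sumM-cong (terms i)) (eqs i)
      where
      terms : ∀ i j → (a i j ·M cons R N x′ ys j) ≈M (a i j ·M cons R N x ys j)
      terms i fzero    = ·M-congʳ (a i fzero) (≈M-sym x≈x′)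
      terms i (fsuc j) = ≈M-refl _

    ⟦⟧-+ : ∀ θ {x y} → ⟦ θ ⟧ᴺ x → ⟦ θ ⟧ᴺ y → ⟦ θ ⟧ᴺ (x +M y)
    ⟦⟧-+ (pp k l a) {x} {y} (ys , eqs) (ys′ , eqs′) = (λ j → ys j +M ys′ j) , λ i →
      ≈M-trans (sumM-cong (terms i))
        (≈M-trans (sumM-+ (λ j → a i j ·M cons R N x ys j) (λ j → a i j ·M cons R N y ys′ j))
        (≈M-trans (+M-congˡ (eqs i))
        (≈M-trans (+M-congʳ (eqs′ i)) 0+M0)))
      where
      terms : ∀ i j → (a i j ·M cons R N (x +M y) (λ j → ys j +M ys′ j) j)
                      ≈M ((a i j ·M cons R N x ys j) +M (a i j ·M cons R N y ys′ j))
      terms i fzero    = ·M-distrib-+M _ _ _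
      terms i (fsuc j) = ·M-distrib-+M _ _ _

    ⟦⟧-· : ∀ θ r {x} → ⟦ θ ⟧ᴺ x → ⟦ θ ⟧ᴺ (r ·M x)
    ⟦⟧-· (pp k l a) r {x} (ys , eqs) = (λ j → r ·M ys j) , λ i →
      ≈M-trans (sumM-cong (terms i))
        (≈M-trans (sumM-· r (λ j → a i j ·M cons R N x ys j))
        (≈M-trans (·M-congʳ r (eqs i)) (·M-0 r)))
      where
      terms : ∀ i j → (a i j ·M cons R N (r ·M x) (λ j → r ·M ys j) j) ≈M (r ·M (a i j ·M cons R N x ys j))
      terms i fzero    = ·M-comm _ _ _
      terms i (fsuc j) = ·M-comm _ _ _

    _∧_ : PP R → PP R → Car → Set
    (φ ∧ ψ) x = ⟦ φ ⟧ᴺ x × ⟦ ψ ⟧ᴺ x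

    IsSimpleQuotient : PP R → PP R → Set
    IsSimpleQuotient φ ψ = ∀ x y → ⟦ φ ⟧ᴺ x → ¬ (φ ∧ ψ) x → ⟦ φ ⟧ᴺ y →
      Σ Carrier λ r → Σ Car λ z → (φ ∧ ψ) z × y ≈M ((r ·M x) +M z)

    simple⇒minimalPair : ∀ φ ψ x₀ → ⟦ φ ⟧ᴺ x₀ → ¬ (φ ∧ ψ) x₀ → IsSimpleQuotient φ ψ → MinimalPair R N φ ψ
    simple⇒minimalPair φ ψ x₀ φx₀ ¬φψx₀ simple = ((λ _ → proj₁) , x₀ , φx₀ , ¬φψx₀) , no-intermediate
      where
      no-intermediate : ¬ Σ (PP R) λ θ → _⊊_ R N ⟦ θ ⟧ᴺ ⟦ φ ⟧ᴺ × _⊊_ R N (φ ∧ ψ) ⟦ θ ⟧ᴺ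
      no-intermediate (θ , (θ⊆φ , y , φy , ¬θy) , (φψ⊆θ , x , θx , ¬φψx)) with simple x y (θ⊆φ x θx) ¬φψx φy
      ... | r , z , φψz , y≈rx+z = ¬θy (⟦⟧-resp θ (≈M-sym y≈rx+z) (⟦⟧-+ θ (⟦⟧-· θ r θx) (φψ⊆θ z φψz)))

    minimalPair-witness : ∀ φ ψ → MinimalPair R N φ ψ → Σ Car λ x → ⟦ φ ⟧ᴺ x × ¬ (φ ∧ ψ) x
    minimalPair-witness φ ψ ((_ , witness) , _) = witness

    intermediate⇒¬minimalPair : ∀ φ ψ θ → _⊊_ R N ⟦ θ ⟧ᴺ ⟦ φ ⟧ᴺ → _⊊_ R N (φ ∧ ψ) ⟦ θ ⟧ᴺ → ¬ MinimalPair R N φ ψ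
    intermediate⇒¬minimalPair φ ψ θ θ⊊φ φψ⊊θ (_ , no-intermediate) = no-intermediate (θ , θ⊊φ , φψ⊊θ)

    ⟦true⟧ : ∀ x → ⟦ ppTrue R ⟧ᴺ x
    ⟦true⟧ x = (λ ()) , (λ ())

    private
      ann-cross : ∀ b x → ((b * num x) * 1# + 0# * den x) * 1# - 0# * (den x * 1#) ≈ b * num x
      ann-cross b x = solve 3 (λ b nx dx → ((b :* nx) :* con (+ 1) :+ con (+ 0) :* dx) :* con (+ 1) :- con (+ 0) :* (dx :* con (+ 1))
                                           := b :* nx) refl b (num x) (den x)

      div-cross : ∀ c x y → ((1# * num x) * (den y * 1#) + (((- c) * num y) * 1# + 0# * den y) * den x) * 1#
                            - 0# * (den x * (den y * 1#)) ≈ num x * den y - (c * num y) * den x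
      div-cross c x y = solve 5 (λ c nx dx ny dy →
          ((con (+ 1) :* nx) :* (dy :* con (+ 1)) :+ (((:- c) :* ny) :* con (+ 1) :+ con (+ 0) :* dy) :* dx) :* con (+ 1)
          :- con (+ 0) :* (dx :* (dy :* con (+ 1)))
        := nx :* dy :- (c :* ny) :* dx) refl c (num x) (den x) (num y) (den y)

    ⟦ann⟧⇒ : ∀ b x → ⟦ ppAnn R b ⟧ᴺ x → P (b * num x)
    ⟦ann⟧⇒ b x (_ , eqs) = P-resp (ann-cross b x) (≈M-elim (↦-+ (↦-· b (↦-self x)) ↦-0) ↦-0 (eqs fzero))

    ⟦ann⟧⇐ : ∀ b x → P (b * num x) → ⟦ ppAnn R b ⟧ᴺ x
    ⟦ann⟧⇐ b x bx∈P = (λ ()) , λ { fzero → ≈M-intro (↦-+ (↦-· b (↦-self x)) ↦-0) ↦-0 (ann-cross b x) bx∈P }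

    ⟦div⟧⇒ : ∀ c x → ⟦ ppDiv R c ⟧ᴺ x → Σ Car λ y → P (num x * den y - (c * num y) * den x)
    ⟦div⟧⇒ c x (ys , eqs) = ys fzero , P-resp (div-cross c x (ys fzero))
      (≈M-elim (↦-+ (↦-· 1# (↦-self x)) (↦-+ (↦-· (- c) (↦-self (ys fzero))) ↦-0)) ↦-0 (eqs fzero))

    ⟦div⟧⇐ : ∀ c x y → P (num x * den y - (c * num y) * den x) → ⟦ ppDiv R c ⟧ᴺ x
    ⟦div⟧⇐ c x y x-cy∈P = (λ _ → y) , λ { fzero →
      ≈M-intro (↦-+ (↦-· 1# (↦-self x)) (↦-+ (↦-· (- c) (↦-self y)) ↦-0)) ↦-0 (div-cross c x y) x-cy∈P }

    ⟦div⟧⇐-exact : ∀ c x y → num x * den y ≈ (c * num y) * den x → ⟦ ppDiv R c ⟧ᴺ x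
    ⟦div⟧⇐-exact c x y x≈cy = ⟦div⟧⇐ c x y (P-resp (sym (x≈y⇒x∙y⁻¹≈ε x≈cy)) P-0)

    ⟦div⟧⇐-zero : ∀ c x → P (num x) → ⟦ ppDiv R c ⟧ᴺ x
    ⟦div⟧⇐-zero c x x∈P = ⟦div⟧⇐ c x 0M (P-resp (sym (begin
      num x * den 0M - (c * num 0M) * den x  ≈⟨ +-cong (*-congˡ den-0) (-‿cong (*-congʳ (*-congˡ num-0))) ⟩
      num x * 1# - (c * 0#) * den x          ≈⟨ solve 3 (λ nx c dx → nx :* con (+ 1) :- (c :* con (+ 0)) :* dx := nx) refl (num x) c (den x) ⟩
      num x                                  ∎)) x∈P)

    den·num≈P-part+c-part : ∀ c x y → den y * num x ≈ (num x * den y - (c * num y) * den x) + c * (num y * den x)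
    den·num≈P-part+c-part c x y = solve 5 (λ c nx dx ny dy → dy :* nx := (nx :* dy :- (c :* ny) :* dx) :+ c :* (ny :* dx))
                                          refl c (num x) (den x) (num y) (den y)

    -- num y / num x lies in R_m; a multiple r x with r ≡ num y / num x modulo m leaves a remainder
    -- in c m R_m, and r is computed from an inverse q of T modulo m.
    approximate : ∀ {c} x y → c ≼ num x → ¬ c ≺ num x → c ≼ num y → Σ Carrier λ r → c ≺ num (y +M ((- r) ·M x))
    approximate {c} x y (divides s u s∉m su≈) ¬c≺x (divides s′ w s′∉m s′w≈) = from-inverse (∉m⇒1∈m+Rx T∉m)
      where
      T = (s′ * u) * den y
      S = (s * w) * den x
      T∉m : ¬ m T
      T∉m = ∉m-* (∉m-* s′∉m (λ u∈m → ¬c≺x (dividesProperly s u s∉m u∈m su≈))) (den∉m y)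
      from-inverse : m+Rx T 1# → Σ Carrier λ r → c ≺ num (y +M ((- r) ·M x))
      from-inverse (p , q , p∈m , 1≈p+Tq) = S * q , dividesProperly (s * s′) (S * p) (∉m-* s∉m s′∉m) (mul∈ S p∈m) (begin
        (s * s′) * num (y +M ((- (S * q)) ·M x))
          ≈⟨ *-congˡ (proj₁ (↦-+ (↦-self y) (↦-· (- (S * q)) (↦-self x)))) ⟩
        (s * s′) * (num y * den x + ((- (S * q)) * num x) * den y)
          ≈⟨ solve 7 (λ s s′ ny dx r nx dy → (s :* s′) :* (ny :* dx :+ ((:- r) :* nx) :* dy)
                                          := (s :* dx) :* (s′ :* ny) :+ ((:- r) :* (s′ :* dy)) :* (s :* nx))
                     refl s s′ (num y) (den x) (S * q) (num x) (den y) ⟩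
        (s * den x) * (s′ * num y) + ((- (S * q)) * (s′ * den y)) * (s * num x)
          ≈⟨ +-cong (*-congˡ s′w≈) (*-congˡ su≈) ⟩
        (s * den x) * (c * w) + ((- (S * q)) * (s′ * den y)) * (c * u)
          ≈⟨ solve 8 (λ s dx c w q s′ dy u → (s :* dx) :* (c :* w) :+ ((:- (((s :* w) :* dx) :* q)) :* (s′ :* dy)) :* (c :* u)
                                          := c :* (((s :* w) :* dx) :* (con (+ 1) :- ((s′ :* u) :* dy) :* q)))
                     refl s (den x) c w q s′ (den y) u ⟩
        c * (S * (1# - T * q))
          ≈⟨ *-congˡ (*-congˡ (+-congʳ 1≈p+Tq)) ⟩
        c * (S * ((p + T * q) - T * q))
          ≈⟨ *-congˡ (*-congˡ (solve 2 (λ p t → (p :+ t) :- t := p) refl p (T * q))) ⟩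
        c * (S * p)
          ∎)

    simple-criterion : ∀ φ ψ c → (∀ x → ⟦ φ ⟧ᴺ x → c ≼ num x) → (∀ z → ⟦ φ ⟧ᴺ z → c ≺ num z → ⟦ ψ ⟧ᴺ z) →
                       IsSimpleQuotient φ ψ
    simple-criterion φ ψ c φ⇒c≼ c≺⇒ψ x y φx ¬φψx φy =
      split (approximate x y (φ⇒c≼ x φx) (λ c≺x → ¬φψx (φx , c≺⇒ψ x φx c≺x)) (φ⇒c≼ y φy))
      where
      split : (Σ Carrier λ r → c ≺ num (y +M ((- r) ·M x))) →
              Σ Carrier λ r → Σ Car λ z → (φ ∧ ψ) z × y ≈M ((r ·M x) +M z)
      split (r , c≺z) = r , y +M ((- r) ·M x) , (φz , c≺⇒ψ _ φz c≺z) , ≈M-·M-+M r x y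
        where
        φz : ⟦ φ ⟧ᴺ (y +M ((- r) ·M x))
        φz = ⟦⟧-+ φ φy (⟦⟧-· φ (- r) φx)

  ≺-saturatedIdeal : ∀ γ → SaturatedIdeal (γ ≺_)
  ≺-saturatedIdeal γ = record
    { P-resp      = ≺-resp-≈ refl
    ; P-0         = ≺-0 γ
    ; P-+         = ≺-+
    ; P-*         = λ k {x} γ≺x → ≺-resp-≈ refl (*-comm x k) (≺-*ʳ k γ≺x)
    ; P-saturated = λ {k} {x} k∉m γ≺kx → ≺-cancel-∉m k∉m (≺-resp-≈ refl (*-comm k x) γ≺kx)
    }

  ≼-saturatedIdeal : ∀ δ → SaturatedIdeal (δ ≼_)
  ≼-saturatedIdeal δ = record
    { P-resp      = ≼-resp-≈ refl
    ; P-0         = ≼-0 δ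
    ; P-+         = ≼-+
    ; P-*         = λ k {x} δ≼x → ≼-resp-≈ refl (*-comm x k) (≼-*ʳ k δ≼x)
    ; P-saturated = λ {k} {x} k∉m δ≼kx → ≼-cancel-∉m k∉m (≼-resp-≈ refl (*-comm k x) δ≼kx)
    }

  private
    -‿*-cross : ∀ a A b B → a * B + (- b) * A ≈ a * B - b * A
    -‿*-cross a A b B = solve 4 (λ a A b B → a :* B :+ (:- b) :* A := a :* B :- b :* A) refl a A b B

  -F~⇒cross : ∀ {a S b T g w W} → ((a , S) -F (b , T)) ~ (g * w , W) →
              prodD W * (a * prodD T - b * prodD S) ≈ g * (w * prodD (S ++ T))
  -F~⇒cross {a} {S} {b} {T} {g} {w} {W} a/S-b/T~gw/W = begin
    prodD W * (a * prodD T - b * prodD S)      ≈⟨ *-congˡ (-‿*-cross a (prodD S) b (prodD T)) ⟨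
    prodD W * (a * prodD T + (- b) * prodD S)  ≈⟨ *-comm _ _ ⟩
    (a * prodD T + (- b) * prodD S) * prodD W  ≈⟨ ~⇒cross {_} {S ++ T} {g * w} {W} a/S-b/T~gw/W ⟩
    (g * w) * prodD (S ++ T)                   ≈⟨ *-assoc g w _ ⟩
    g * (w * prodD (S ++ T))                   ∎

  cross⇒-F~ : ∀ {a S b T g s u} (s∉m : ¬ m s) → s * (a * prodD T - b * prodD S) ≈ g * u →
              ((a , S) -F (b , T)) ~ (g * u , (s , s∉m) ∷ S ++ T)
  cross⇒-F~ {a} {S} {b} {T} {g} {s} {u} s∉m eq = cross⇒~ {_} {S ++ T} {g * u} {(s , s∉m) ∷ S ++ T} (begin
    (a * prodD T + (- b) * prodD S) * (s * prodD (S ++ T))  ≈⟨ *-congʳ (-‿*-cross a (prodD S) b (prodD T)) ⟩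
    (a * prodD T - b * prodD S) * (s * prodD (S ++ T))      ≈⟨ solve 3 (λ d s p → d :* (s :* p) := (s :* d) :* p) refl _ s _ ⟩
    (s * (a * prodD T - b * prodD S)) * prodD (S ++ T)      ≈⟨ *-congʳ eq ⟩
    (g * u) * prodD (S ++ T)                                ∎)

  QuotγmRm-presentation : ∀ γ → FractionPresentation (QuotγmRm γ)
  QuotγmRm-presentation γ = record
    { P       = γ ≺_
    ; P-ideal = ≺-saturatedIdeal γ
    ; num     = proj₁
    ; den     = λ x → prodD (proj₂ x)
    ; den∉m   = λ x → prodD-∉m (proj₂ x)
    ; ≈M⇒P    = λ { {a , S} {b , T} (w , W , w∈m , x-y~γw) →
                    dividesProperly (prodD W) (w * prodD (S ++ T)) (prodD-∉m W) (m-*ʳ _ w∈m)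
                      (-F~⇒cross {a} {S} {b} {T} {γ} {w} {W} x-y~γw) }
    ; P⇒≈M    = λ { {a , S} {b , T} (dividesProperly s u s∉m u∈m eq) →
                    u , (s , s∉m) ∷ S ++ T , u∈m , cross⇒-F~ {a} {S} {b} {T} s∉m eq }
    ; num-+   = λ _ _ → refl
    ; den-+   = λ x y → prodD-++ (proj₂ x) (proj₂ y)
    ; num-0   = refl
    ; den-0   = refl
    ; num-·   = λ _ _ → refl
    ; den-·   = λ _ _ → refl
    }

  module _ where
    open MR ideal

    QuotmRmδ-presentation : ∀ δ → FractionPresentation (QuotmRmδ δ)
    QuotmRmδ-presentation δ = record
      { P       = δ ≼_
      ; P-ideal = ≼-saturatedIdeal δ
      ; num     = λ x → proj₁ (proj₁ x)
      ; den     = λ x → prodD (proj₂ x)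
      ; den∉m   = λ x → prodD-∉m (proj₂ x)
      ; ≈M⇒P    = λ { {(a , _) , S} {(b , _) , T} ((w , W) , x-y~δw) →
                      divides (prodD W) (w * prodD (S ++ T)) (prodD-∉m W) (-F~⇒cross {a} {S} {b} {T} {δ} {w} {W} x-y~δw) }
      ; P⇒≈M    = λ { {(a , _) , S} {(b , _) , T} (divides s u s∉m eq) →
                      (u , (s , s∉m) ∷ S ++ T) , cross⇒-F~ {a} {S} {b} {T} s∉m eq }
      ; num-+   = λ _ _ → +-cong (*-comm _ _) (*-comm _ _)
      ; den-+   = λ x y → prodD-++ (proj₂ x) (proj₂ y)
      ; num-0   = refl
      ; den-0   = refl
      ; num-·   = λ _ _ → refl
      ; den-·   = λ _ _ → refl
      }

  module _ (valuation : IsValuation) (dense : DenseValueGroup) where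

    ≺-dense-above₂ : ∀ {a a′ c} → a ≺ c → a′ ≺ c → ¬ c ≈ 0# → Σ Carrier λ x → a ≺ x × a′ ≺ x × x ≺ c
    ≺-dense-above₂ {a} {a′} a≺c a′≺c c≉0 with ≼-total valuation a a′
    ... | inj₁ a≼a′ with ≺-dense dense a′≺c c≉0
    ...   | x , a′≺x , x≺c = x , ≼-≺-trans a≼a′ a′≺x , a′≺x , x≺c
    ≺-dense-above₂ {a} {a′} a≺c a′≺c c≉0 | inj₂ a′≼a with ≺-dense dense a≺c c≉0
    ...   | x , a≺x , x≺c = x , a≺x , ≼-≺-trans a′≼a a≺x , x≺c

    ≺-dense-below₂ : ∀ {a b b′} → a ≺ b → a ≺ b′ → ¬ b′ ≈ 0# → Σ Carrier λ x → a ≺ x × x ≺ b × x ≺ b′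
    ≺-dense-below₂ {a} {b} {b′} a≺b a≺b′ b′≉0 with ≼-total valuation b b′
    ... | inj₁ b≼b′ with ≺-dense dense a≺b (≼-≉0 b≼b′ b′≉0)
    ...   | x , a≺x , x≺b = x , a≺x , x≺b , ≺-≼-trans x≺b b≼b′
    ≺-dense-below₂ {a} {b} {b′} a≺b a≺b′ b′≉0 | inj₂ b′≼b with ≺-dense dense a≺b′ b′≉0
    ...   | x , a≺x , x≺b′ = x , a≺x , ≺-≼-trans x≺b′ b′≼b , x≺b′

    -- If g / b ∈ R_m any x ∈ m will do; otherwise x is chosen above g / b.
    ≺-*-dense : ∀ {a b c g} → ¬ g ≈ 0# → a ≺ c → g ≺ b * c → ¬ c ≈ 0# → Σ Carrier λ x → a ≺ x × x ≺ c × g ≺ b * x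
    ≺-*-dense {a} {b} {c} {g} g≉0 a≺c g≺bc c≉0 with ≼-total valuation g b
    ... | inj₁ g≼b with ≺-dense dense a≺c c≉0
    ...   | x , a≺x , x≺c = x , a≺x , x≺c , ≼-≺-trans g≼b (a≺a*b b (≺⇒∈m a≺x))
    ≺-*-dense {a} {b} {c} {g} g≉0 a≺c g≺bc c≉0 | inj₂ b≼g@(divides s w s∉m sg≈bw)
      with ≺-dense-above₂ a≺c (≺-*-cancelˡ (≼-≉0 b≼g g≉0) (≼-≺-trans bw≼g g≺bc)) c≉0
      where
      bw≼g : b * w ≼ g
      bw≼g = divides s 1# s∉m (trans sg≈bw (sym (*-identityʳ _)))
    ... | x , a≺x , w≺x , x≺c = x , a≺x , x≺c , ≼-≺-trans (≼-flip proper (trans sg≈bw (sym (*-identityʳ _)))) (≺-*-monoˡ b w≺x)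

    module InQuotγmRm (γ : Carrier) (γ≉0 : ¬ γ ≈ 0#) where
      open PresentedModule (QuotγmRm-presentation γ)
      open FractionPresentation (QuotγmRm-presentation γ) using (num; den; den∉m)

      ⟦div⟧⇒≼⊎≻ : ∀ c x → ⟦ ppDiv R c ⟧ᴺ x → c ≼ proj₁ x ⊎ γ ≺ proj₁ x
      ⟦div⟧⇒≼⊎≻ c x c∣x = let y , γ≺D = ⟦div⟧⇒ c x c∣x in
        [ (λ c≼D → inj₁ (≼-cancel-∉m (den∉m y) (≼-resp-≈ refl (split y) (≼-+ c≼D (a≼a*b c _)))))
        , (λ D≺c → inj₂ (≺-cancel-∉m (den∉m y) (≺-resp-≈ refl (split y) (≺-+ γ≺D (≺-*ʳ _ (≺-≼-trans γ≺D (≺⇒≼ D≺c)))))))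
        ]′ (≼-or-≻ valuation c (num x * den y - (c * num y) * den x))
        where
        split : ∀ y → (num x * den y - (c * num y) * den x) + c * (num y * den x) ≈ num x * den y
        split y = trans (sym (den·num≈P-part+c-part c x y)) (*-comm _ _)

      ≼⊎≻⇒⟦div⟧ : ∀ c x → c ≼ proj₁ x ⊎ γ ≺ proj₁ x → ⟦ ppDiv R c ⟧ᴺ x
      ≼⊎≻⇒⟦div⟧ c (r , S) (inj₁ (divides s u s∉m sr≈cu)) = ⟦div⟧⇐-exact c (r , S) (u , (s , s∉m) ∷ S) (begin
        r * (s * prodD S)   ≈⟨ solve 3 (λ r s p → r :* (s :* p) := (s :* r) :* p) refl r s (prodD S) ⟩
        (s * r) * prodD S   ≈⟨ *-congʳ sr≈cu ⟩
        (c * u) * prodD S   ∎)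
      ≼⊎≻⇒⟦div⟧ c x (inj₂ γ≺x) = ⟦div⟧⇐-zero c x γ≺x

      ≺⇒¬minimal-true-ann : ∀ {d} → d ≺ γ → ¬ MinimalPair R (QuotγmRm γ) (ppTrue R) (ppAnn R d)
      ≺⇒¬minimal-true-ann {d} d≺γ = factored (≺-factor dense d≺γ γ≉0)
        where
        factored : (Σ Carrier λ e → Σ Carrier λ f → m e × m f × (d * e) * f ≈ᵥ γ) →
                   ¬ MinimalPair R (QuotγmRm γ) (ppTrue R) (ppAnn R d)
        factored (e , f , e∈m , f∈m , def≼γ , γ≼def) =
          intermediate⇒¬minimalPair (ppTrue R) (ppAnn R d) (ppAnn R (d * e)) θ⊊true ann⊊θ
          where
          def≉0 : ¬ (d * e) * f ≈ 0#
          def≉0 = ≼-≉0 def≼γ γ≉0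
          θ⊊true : _⊊_ R (QuotγmRm γ) ⟦ ppAnn R (d * e) ⟧ᴺ ⟦ ppTrue R ⟧ᴺ
          θ⊊true = (λ x _ → ⟦true⟧ x) , ι f , ⟦true⟧ (ι f) , λ θf → ≺-asym (⟦ann⟧⇒ (d * e) (ι f) θf) def≼γ def≉0
          ann⊊θ : _⊊_ R (QuotγmRm γ) (ppTrue R ∧ ppAnn R d) ⟦ ppAnn R (d * e) ⟧ᴺ
          ann⊊θ = (λ z (_ , ann-z) → ⟦ann⟧⇐ (d * e) z (≺-≼-trans (⟦ann⟧⇒ d z ann-z)
                     (≼-resp-≈ refl (solve 3 (λ d e n → (d :* n) :* e := (d :* e) :* n) refl d e (proj₁ z)) (a≼a*b _ e))))
                , ι (e * f)
                , ⟦ann⟧⇐ (d * e) (ι (e * f)) (≼-≺-trans γ≼def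
                    (≺-resp-≈ refl (solve 3 (λ d e f → ((d :* e) :* f) :* e := (d :* e) :* (e :* f)) refl d e f) (a≺a*b _ e∈m)))
                , λ (_ , ann-ef) → ≺-asym (≺-resp-≈ refl (sym (*-assoc d e f)) (⟦ann⟧⇒ d (ι (e * f)) ann-ef)) def≼γ def≉0

      minimal-true-ann⇒≈ᵥ : ∀ d → MinimalPair R (QuotγmRm γ) (ppTrue R) (ppAnn R d) → γ ≈ᵥ d
      minimal-true-ann⇒≈ᵥ d minimal = by-comparison (compare valuation γ d)
        where
        by-comparison : Compare valuation γ d → γ ≈ᵥ d
        by-comparison (less γ≺d) = let x , _ , ¬ann = minimalPair-witness (ppTrue R) (ppAnn R d) minimal in
          contradiction (⟦true⟧ x , ⟦ann⟧⇐ d x (≺-*ʳ (proj₁ x) γ≺d)) ¬ann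
        by-comparison (equiv γ≈ᵥd)  = γ≈ᵥd
        by-comparison (greater d≺γ) = contradiction minimal (≺⇒¬minimal-true-ann d≺γ)

      ≈ᵥ⇒minimal-true-ann : ∀ d → γ ≈ᵥ d → MinimalPair R (QuotγmRm γ) (ppTrue R) (ppAnn R d)
      ≈ᵥ⇒minimal-true-ann d (γ≼d , d≼γ) = simple⇒minimalPair (ppTrue R) (ppAnn R d) (ι 1#) (⟦true⟧ (ι 1#))
        (λ (_ , ann-1) → ≺-asym (≺-resp-≈ refl (*-identityʳ d) (⟦ann⟧⇒ d (ι 1#) ann-1)) d≼γ (≼-≉0 d≼γ γ≉0))
        (simple-criterion (ppTrue R) (ppAnn R d) 1# (λ x _ → ∉m⇒≼ (proj₁ x) proper)
          (λ z _ 1≺z → ⟦ann⟧⇐ d z (≼-≺-trans γ≼d (a≺a*b d (≺⇒∈m 1≺z)))))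

      ∉m∈m∈m⇒minimal-ann-div : ∀ b c → ¬ m γ → m b → m c → MinimalPair R (QuotγmRm γ) (ppAnn R b) (ppDiv R c)
      ∉m∈m∈m⇒minimal-ann-div b c γ∉m b∈m c∈m = simple⇒minimalPair (ppAnn R b) (ppDiv R c) (ι 1#) (ann-all (ι 1#))
        (λ (_ , c∣1) → [ (λ c≼1 → proper (≼-∈m c∈m c≼1)) , (λ γ≺1 → proper (≺⇒∈m γ≺1)) ]′ (⟦div⟧⇒≼⊎≻ c (ι 1#) c∣1))
        (simple-criterion (ppAnn R b) (ppDiv R c) 1# (λ x _ → ∉m⇒≼ (proj₁ x) proper)
          (λ z _ 1≺z → ≼⊎≻⇒⟦div⟧ c z (inj₂ (∉m⇒≺ γ∉m (≺⇒∈m 1≺z)))))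
        where
        ann-all : ∀ x → ⟦ ppAnn R b ⟧ᴺ x
        ann-all x = ⟦ann⟧⇐ b x (∉m⇒≺ γ∉m (m-*ʳ (proj₁ x) b∈m))

      record IntermediateDivisor (b c : Carrier) : Set where
        field
          c′ x  : Carrier
          γ≺bx  : γ ≺ b * x
          x≺c′  : x ≺ c′
          c′≼γ  : c′ ≼ γ
          c′≼c  : c′ ≼ c
          c⋠c′  : ¬ c ≼ c′

      intermediateDivisor : ∀ {b c n} → m γ → m b → γ ≺ b * n → n ≺ c → IntermediateDivisor b c
      intermediateDivisor {b} {c} {n} γ∈m b∈m γ≺bn n≺c = [ c-below-γ , γ-below-c ]′ (≼-total valuation c γ)
        where
        c-below-γ : c ≼ γ → IntermediateDivisor b c
        c-below-γ c≼γ = let c′ , n≺c′ , c′≺c = ≺-dense dense n≺c (≼-≉0 c≼γ γ≉0) in record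
          { c′ = c′ ; x = n ; γ≺bx = γ≺bn ; x≺c′ = n≺c′ ; c′≼γ = ≺⇒≼ (≺-≼-trans c′≺c c≼γ) ; c′≼c = ≺⇒≼ c′≺c
          ; c⋠c′ = λ c≼c′ → ≺-asym c′≺c c≼c′ (≼-≉0 c≼γ γ≉0) }
        γ-below-c : γ ≼ c → IntermediateDivisor b c
        γ-below-c γ≼c =
          let x , _ , x≺γ , γ≺bx = ≺-*-dense γ≉0 (1≺ γ∈m) (≺-resp-≈ refl (*-comm γ b) (a≺a*b γ b∈m)) γ≉0
              c′ , x≺c′ , c′≺γ = ≺-dense dense x≺γ γ≉0
          in record
          { c′ = c′ ; x = x ; γ≺bx = γ≺bx ; x≺c′ = x≺c′ ; c′≼γ = ≺⇒≼ c′≺γ ; c′≼c = ≺⇒≼ (≺-≼-trans c′≺γ γ≼c)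
          ; c⋠c′ = λ c≼c′ → ≺-asym c′≺γ (≼-trans γ≼c c≼c′) γ≉0 }

      intermediateDivisor⇒¬minimal : ∀ {b c} → IntermediateDivisor b c → ¬ MinimalPair R (QuotγmRm γ) (ppAnn R b) (ppDiv R c)
      intermediateDivisor⇒¬minimal {b} {c} i =
        intermediate⇒¬minimalPair (ppAnn R b) (ppDiv R c) (ppDiv R c′) θ⊊ann ann∧div⊊θ
        where
        open IntermediateDivisor i
        c′≉0 : ¬ c′ ≈ 0#
        c′≉0 = ≼-≉0 c′≼γ γ≉0
        θ⊊ann : _⊊_ R (QuotγmRm γ) ⟦ ppDiv R c′ ⟧ᴺ ⟦ ppAnn R b ⟧ᴺ
        θ⊊ann = (λ z c′∣z → ⟦ann⟧⇐ b z ([ (λ c′≼z → ≺-≼-trans γ≺bx (≼-*-monoˡ b (≼-trans (≺⇒≼ x≺c′) c′≼z)))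
                                          , (λ γ≺z → ≺-resp-≈ refl (*-comm _ b) (≺-*ʳ b γ≺z)) ]′ (⟦div⟧⇒≼⊎≻ c′ z c′∣z)))
              , ι x , ⟦ann⟧⇐ b (ι x) γ≺bx
              , λ c′∣x → [ (λ c′≼x → ≺-asym x≺c′ c′≼x c′≉0)
                         , (λ γ≺x → ≺-asym γ≺x (≺⇒≼ (≺-≼-trans x≺c′ c′≼γ)) (≺-≉0 (≺-≼-trans x≺c′ c′≼γ) γ≉0)) ]′
                         (⟦div⟧⇒≼⊎≻ c′ (ι x) c′∣x)
        ann∧div⊊θ : _⊊_ R (QuotγmRm γ) (ppAnn R b ∧ ppDiv R c) ⟦ ppDiv R c′ ⟧ᴺ
        ann∧div⊊θ = (λ z (_ , c∣z) → ≼⊎≻⇒⟦div⟧ c′ z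
                       ([ (λ c≼z → inj₁ (≼-trans c′≼c c≼z)) , inj₂ ]′ (⟦div⟧⇒≼⊎≻ c z c∣z)))
                  , ι c′ , ≼⊎≻⇒⟦div⟧ c′ (ι c′) (inj₁ (≼-refl c′))
                  , λ (_ , c∣c′) → [ c⋠c′ , (λ γ≺c′ → ≺-asym γ≺c′ c′≼γ c′≉0) ]′ (⟦div⟧⇒≼⊎≻ c (ι c′) c∣c′)

      minimal-ann-div⇒∉m∈m∈m : ∀ b c → MinimalPair R (QuotγmRm γ) (ppAnn R b) (ppDiv R c) → ¬ m γ × m b × m c
      minimal-ann-div⇒∉m∈m∈m b c minimal = from-witness (minimalPair-witness (ppAnn R b) (ppDiv R c) minimal)
        where
        from-witness : (Σ Frac λ x → ⟦ ppAnn R b ⟧ᴺ x × ¬ (ppAnn R b ∧ ppDiv R c) x) → ¬ m γ × m b × m c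
        from-witness (x₀@(n₀ , _) , ann-x₀ , ¬ann∧div) = γ∉m , b∈m , c∈m
          where
          γ≺bn₀ : γ ≺ b * n₀
          γ≺bn₀ = ⟦ann⟧⇒ b x₀ ann-x₀
          c∤x₀ : ¬ ⟦ ppDiv R c ⟧ᴺ x₀
          c∤x₀ c∣x₀ = ¬ann∧div (ann-x₀ , c∣x₀)
          b∈m : m b
          b∈m = m-stable λ b∉m → c∤x₀ (≼⊎≻⇒⟦div⟧ c x₀ (inj₂ (≺-cancel-∉m b∉m (≺-resp-≈ refl (*-comm b n₀) γ≺bn₀))))
          c∈m : m c
          c∈m = m-stable λ c∉m → c∤x₀ (≼⊎≻⇒⟦div⟧ c x₀ (inj₁ (∉m⇒≼ n₀ c∉m)))
          γ∉m : ¬ m γ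
          γ∉m γ∈m = intermediateDivisor⇒¬minimal
            (intermediateDivisor γ∈m b∈m γ≺bn₀ (⋠⇒≻ valuation λ c≼n₀ → c∤x₀ (≼⊎≻⇒⟦div⟧ c x₀ (inj₁ c≼n₀)))) minimal

    module InQuotmRmδ (δ : Carrier) (δ≉0 : ¬ δ ≈ 0#) where
      open MR ideal using (MFrac; QuotmRmδ)
      open PresentedModule (QuotmRmδ-presentation δ)
      open FractionPresentation (QuotmRmδ-presentation δ) using (num; den; den∉m)

      ιₘ : ∀ r → m r → MFrac
      ιₘ r r∈m = (r , r∈m) , []

      ⟦div⟧⇒≺⊎≽ : ∀ c x → ⟦ ppDiv R c ⟧ᴺ x → c ≺ num x ⊎ δ ≼ num x
      ⟦div⟧⇒≺⊎≽ c x c∣x = let y@((ny , ny∈m) , _) , δ≼D = ⟦div⟧⇒ c x c∣x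
                              c≺cy = a≺a*b c (m-*ʳ (den x) ny∈m) in
        [ (λ δ≼cy → inj₂ (≼-cancel-∉m (den∉m y) (≼-resp-≈ refl (split y) (≼-+ δ≼D δ≼cy))))
        , (λ cy≺δ → inj₁ (≺-cancel-∉m (den∉m y)
                        (≺-resp-≈ refl (split y) (≺-+ (≺-≼-trans (≺-≼-trans c≺cy (≺⇒≼ cy≺δ)) δ≼D) c≺cy))))
        ]′ (≼-or-≻ valuation δ (c * (ny * den x)))
        where
        split : ∀ y → (num x * den y - (c * num y) * den x) + c * (num y * den x) ≈ num x * den y
        split y = trans (sym (den·num≈P-part+c-part c x y)) (*-comm _ _)

      ≺⊎≽⇒⟦div⟧ : ∀ c x → c ≺ num x ⊎ δ ≼ num x → ⟦ ppDiv R c ⟧ᴺ x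
      ≺⊎≽⇒⟦div⟧ c x@((r , _) , S) (inj₁ (dividesProperly s u s∉m u∈m sr≈cu)) =
        ⟦div⟧⇐-exact c x ((u , u∈m) , (s , s∉m) ∷ S) (begin
          r * (s * prodD S)   ≈⟨ solve 3 (λ r s p → r :* (s :* p) := (s :* r) :* p) refl r s (prodD S) ⟩
          (s * r) * prodD S   ≈⟨ *-congʳ sr≈cu ⟩
          (c * u) * prodD S   ∎)
      ≺⊎≽⇒⟦div⟧ c x (inj₂ δ≼x) = ⟦div⟧⇐-zero c x δ≼x

      ⟦div⟧-mono : ∀ {a c} → a ≼ c → ∀ z → ⟦ ppDiv R c ⟧ᴺ z → ⟦ ppDiv R a ⟧ᴺ z
      ⟦div⟧-mono a≼c z c∣z = ≺⊎≽⇒⟦div⟧ _ z ([ (λ c≺z → inj₁ (≼-≺-trans a≼c c≺z)) , inj₂ ]′ (⟦div⟧⇒≺⊎≽ _ z c∣z))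

      ⟦div⟧⊆⟦ann⟧ : ∀ {a b} → δ ≼ b * a → ∀ z → ⟦ ppDiv R a ⟧ᴺ z → ⟦ ppAnn R b ⟧ᴺ z
      ⟦div⟧⊆⟦ann⟧ {a} {b} δ≼ba z a∣z = ⟦ann⟧⇐ b z
        ([ (λ a≺z → ≼-trans δ≼ba (≼-*-monoˡ b (≺⇒≼ a≺z))) , (λ δ≼z → ≼-resp-≈ refl (*-comm _ b) (≼-*ʳ b δ≼z)) ]′
         (⟦div⟧⇒≺⊎≽ a z a∣z))

      ≺⇒¬minimal-true-ann : ∀ {d} x₀ → d * num x₀ ≺ δ → ¬ MinimalPair R (QuotmRmδ δ) (ppTrue R) (ppAnn R d)
      ≺⇒¬minimal-true-ann {d} x₀@((n₀ , n₀∈m) , _) dn₀≺δ = factored (≺-factor dense dn₀≺δ δ≉0)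
        where
        factored : (Σ Carrier λ e → Σ Carrier λ f → m e × m f × ((d * n₀) * e) * f ≈ᵥ δ) →
                   ¬ MinimalPair R (QuotmRmδ δ) (ppTrue R) (ppAnn R d)
        factored (e , f , e∈m , f∈m , K≼δ , δ≼K) =
          intermediate⇒¬minimalPair (ppTrue R) (ppAnn R d) (ppAnn R (d * e)) θ⊊true ann⊊θ
          where
          n₀f = ιₘ (n₀ * f) (m-*ʳ f n₀∈m)
          θ⊊true : _⊊_ R (QuotmRmδ δ) ⟦ ppAnn R (d * e) ⟧ᴺ ⟦ ppTrue R ⟧ᴺ
          θ⊊true = (λ x _ → ⟦true⟧ x) , x₀ , ⟦true⟧ x₀ , λ θx₀ → ≺-asym
            (≺-≼-trans (≺-resp-≈ (solve 3 (λ d n e → (d :* n) :* e := (d :* e) :* n) refl d n₀ e) refl (a≺a*b _ f∈m)) K≼δ)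
            (⟦ann⟧⇒ (d * e) x₀ θx₀) δ≉0
          ann⊊θ : _⊊_ R (QuotmRmδ δ) (ppTrue R ∧ ppAnn R d) ⟦ ppAnn R (d * e) ⟧ᴺ
          ann⊊θ = (λ z (_ , ann-z) → ⟦ann⟧⇐ (d * e) z (≼-trans (⟦ann⟧⇒ d z ann-z)
                     (≼-resp-≈ refl (solve 3 (λ d e n → (d :* n) :* e := (d :* e) :* n) refl d e (num z)) (a≼a*b _ e))))
                , n₀f
                , ⟦ann⟧⇐ (d * e) n₀f (≼-resp-≈ refl (solve 4 (λ d n e f → ((d :* n) :* e) :* f := (d :* e) :* (n :* f)) refl d n₀ e f) δ≼K)
                , λ (_ , ann-n₀f) → ≺-asym
                    (≺-≼-trans (≺-resp-≈ refl (solve 4 (λ d n f e → (d :* (n :* f)) :* e := ((d :* n) :* e) :* f) refl d n₀ f e) (a≺a*b _ e∈m)) K≼δ)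
                    (⟦ann⟧⇒ d n₀f ann-n₀f) δ≉0

      ¬minimal-true-ann : ∀ d → ¬ MinimalPair R (QuotmRmδ δ) (ppTrue R) (ppAnn R d)
      ¬minimal-true-ann d minimal = let x₀ , _ , ¬ann = minimalPair-witness (ppTrue R) (ppAnn R d) minimal in
        ≺⇒¬minimal-true-ann x₀ (⋠⇒≻ valuation λ δ≼dn₀ → ¬ann (⟦true⟧ x₀ , ⟦ann⟧⇐ d x₀ δ≼dn₀)) minimal

      ∈m∈m≈ᵥ⇒minimal-ann-div : ∀ b c → m c → m b → b * c ≈ᵥ δ → MinimalPair R (QuotmRmδ δ) (ppAnn R b) (ppDiv R c)
      ∈m∈m≈ᵥ⇒minimal-ann-div b c c∈m b∈m (bc≼δ , δ≼bc) =
        simple⇒minimalPair (ppAnn R b) (ppDiv R c) (ιₘ c c∈m) (⟦ann⟧⇐ b (ιₘ c c∈m) δ≼bc)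
          (λ (_ , c∣c) → [ (λ c≺c → ≺-irrefl c≺c c≉0) , (λ δ≼c → ≺-asym c≺bc (≼-trans bc≼δ δ≼c) bc≉0) ]′
                           (⟦div⟧⇒≺⊎≽ c (ιₘ c c∈m) c∣c))
          (simple-criterion (ppAnn R b) (ppDiv R c) c (λ x ann-x → ≼-*-cancelˡ b≉0 (≼-trans bc≼δ (⟦ann⟧⇒ b x ann-x)))
            (λ z _ c≺z → ≺⊎≽⇒⟦div⟧ c z (inj₁ c≺z)))
        where
        bc≉0 : ¬ b * c ≈ 0#
        bc≉0 = ≼-≉0 bc≼δ δ≉0
        b≉0 : ¬ b ≈ 0#
        b≉0 b≈0 = bc≉0 (trans (*-congʳ b≈0) (zeroˡ c))
        c≉0 : ¬ c ≈ 0#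
        c≉0 c≈0 = bc≉0 (trans (*-congˡ c≈0) (zeroʳ b))
        c≺bc : c ≺ b * c
        c≺bc = ≺-resp-≈ refl (*-comm c b) (a≺a*b c b∈m)

      ≺-witness⇒¬minimal-ann-div : ∀ {b c} x₀ → δ ≼ b * num x₀ → ¬ δ ≼ num x₀ → num x₀ ≺ c →
                                    ¬ MinimalPair R (QuotmRmδ δ) (ppAnn R b) (ppDiv R c)
      ≺-witness⇒¬minimal-ann-div {b} {c} x₀ δ≼bn₀ δ⋠n₀ n₀≺c =
        let x₁ , n₀≺x₁ , x₁≺c , x₁≺δ = ≺-dense-below₂ n₀≺c (⋠⇒≻ valuation δ⋠n₀) δ≉0
            x = ιₘ x₁ (≺⇒∈m n₀≺x₁)
            θ⊊ann = ⟦div⟧⊆⟦ann⟧ δ≼bn₀ , x₀ , ⟦ann⟧⇐ b x₀ δ≼bn₀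
                  , λ n₀∣x₀ → [ (λ n₀≺n₀ → ≺-irrefl n₀≺n₀ n₀≉0) , δ⋠n₀ ]′ (⟦div⟧⇒≺⊎≽ (num x₀) x₀ n₀∣x₀)
            ann∧div⊊θ = (λ z → ⟦div⟧-mono (≺⇒≼ n₀≺c) z ∘ proj₂) , x , ≺⊎≽⇒⟦div⟧ (num x₀) x (inj₁ n₀≺x₁)
                      , λ (_ , c∣x₁) → [ (λ c≺x₁ → ≺-asym c≺x₁ (≺⇒≼ x₁≺c) (≺-≉0 x₁≺δ δ≉0))
                                       , (λ δ≼x₁ → ≺-asym x₁≺δ δ≼x₁ δ≉0) ]′
                                       (⟦div⟧⇒≺⊎≽ c x c∣x₁)
        in intermediate⇒¬minimalPair (ppAnn R b) (ppDiv R c) (ppDiv R (num x₀)) θ⊊ann ann∧div⊊θ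
        where
        n₀≉0 : ¬ num x₀ ≈ 0#
        n₀≉0 n₀≈0 = δ⋠n₀ (≼-resp-≈ refl (sym n₀≈0) (≼-0 δ))

      ≻-product⇒¬minimal-ann-div : ∀ {b c} → m c → c ≺ δ → δ ≺ b * c → ¬ MinimalPair R (QuotmRmδ δ) (ppAnn R b) (ppDiv R c)
      ≻-product⇒¬minimal-ann-div {b} {c} c∈m c≺δ δ≺bc =
        let c′ , 1≺c′ , c′≺c , δ≺bc′ = ≺-*-dense δ≉0 (1≺ c∈m) δ≺bc c≉0
            y = ιₘ c′ (≺⇒∈m 1≺c′)
            x = ιₘ c c∈m
            θ⊊ann = ⟦div⟧⊆⟦ann⟧ (≺⇒≼ δ≺bc′) , y , ⟦ann⟧⇐ b y (≺⇒≼ δ≺bc′)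
                  , λ c′∣c′ → [ (λ c′≺c′ → ≺-irrefl c′≺c′ (≺-≉0 c′≺c c≉0))
                              , (λ δ≼c′ → ≺-asym (≺-≼-trans c′≺c (≺⇒≼ c≺δ)) δ≼c′ δ≉0) ]′
                                (⟦div⟧⇒≺⊎≽ c′ y c′∣c′)
            ann∧div⊊θ = (λ z → ⟦div⟧-mono (≺⇒≼ c′≺c) z ∘ proj₂) , x , ≺⊎≽⇒⟦div⟧ c′ x (inj₁ c′≺c)
                      , λ (_ , c∣c) → [ (λ c≺c → ≺-irrefl c≺c c≉0) , (λ δ≼c → ≺-asym c≺δ δ≼c δ≉0) ]′ (⟦div⟧⇒≺⊎≽ c x c∣c)
        in intermediate⇒¬minimalPair (ppAnn R b) (ppDiv R c) (ppDiv R c′) θ⊊ann ann∧div⊊θ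
        where
        c≉0 : ¬ c ≈ 0#
        c≉0 = ≺-≉0 c≺δ δ≉0

      minimal-ann-div⇒∈m∈m≈ᵥ : ∀ b c → MinimalPair R (QuotmRmδ δ) (ppAnn R b) (ppDiv R c) → m c × m b × b * c ≈ᵥ δ
      minimal-ann-div⇒∈m∈m≈ᵥ b c minimal = from-witness (minimalPair-witness (ppAnn R b) (ppDiv R c) minimal)
        where
        from-witness : (Σ MFrac λ x → ⟦ ppAnn R b ⟧ᴺ x × ¬ (ppAnn R b ∧ ppDiv R c) x) → m c × m b × b * c ≈ᵥ δ
        from-witness (x₀@((n₀ , n₀∈m) , _) , ann-x₀ , ¬ann∧div) = c∈m , b∈m , by-comparison (compare valuation c n₀)
          where
          δ≼bn₀ : δ ≼ b * n₀
          δ≼bn₀ = ⟦ann⟧⇒ b x₀ ann-x₀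
          c∤x₀ : ¬ ⟦ ppDiv R c ⟧ᴺ x₀
          c∤x₀ c∣x₀ = ¬ann∧div (ann-x₀ , c∣x₀)
          δ⋠n₀ : ¬ δ ≼ n₀
          δ⋠n₀ δ≼n₀ = c∤x₀ (≺⊎≽⇒⟦div⟧ c x₀ (inj₂ δ≼n₀))
          c∈m : m c
          c∈m = m-stable λ c∉m → c∤x₀ (≺⊎≽⇒⟦div⟧ c x₀ (inj₁ (∉m⇒≺ c∉m n₀∈m)))
          b∈m : m b
          b∈m = m-stable λ b∉m → δ⋠n₀ (≼-cancel-∉m b∉m (≼-resp-≈ refl (*-comm b n₀) δ≼bn₀))
          by-product-comparison : c ≼ n₀ → δ ≼ b * c → Compare valuation (b * c) δ → b * c ≈ᵥ δ
          by-product-comparison _   δ≼bc (less bc≺δ)    = contradiction δ≼bc (λ δ≼bc → ≺-asym bc≺δ δ≼bc δ≉0)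
          by-product-comparison _   _    (equiv bc≈ᵥδ)  = bc≈ᵥδ
          by-product-comparison c≼n₀ _   (greater δ≺bc) =
            contradiction minimal (≻-product⇒¬minimal-ann-div c∈m (≼-≺-trans c≼n₀ (⋠⇒≻ valuation δ⋠n₀)) δ≺bc)
          by-comparison : Compare valuation c n₀ → b * c ≈ᵥ δ
          by-comparison (less c≺n₀)            = contradiction (≺⊎≽⇒⟦div⟧ c x₀ (inj₁ c≺n₀)) c∤x₀
          by-comparison (greater n₀≺c)         = contradiction minimal (≺-witness⇒¬minimal-ann-div x₀ δ≼bn₀ δ⋠n₀ n₀≺c)
          by-comparison (equiv (c≼n₀ , n₀≼c)) =
            by-product-comparison c≼n₀ (≼-trans δ≼bn₀ (≼-*-monoˡ b n₀≼c)) (compare valuation (b * c) δ)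

lemma5p4 : (R : CommutativeRing 0ℓ 0ℓ) → IsDomain R → IsPrufer R → AllDense R →
    let open CommutativeRing R in
    (b c d : Carrier) (m : Carrier → Set) (mmax : IsMaximal R m) →
    (γ : Carrier) → ¬ (γ ≈ 0#) → (δ : Carrier) → m δ → ¬ (δ ≈ 0#) →
    let open Loc R m
        open MR (IsMaximal.ideal mmax)
    in (MinimalPair R (QuotγmRm γ) (ppTrue R) (ppAnn R d) ⇔ SamePrincipal (ι γ) (ι d))
       × (MinimalPair R (QuotγmRm γ) (ppAnn R b) (ppDiv R c) ⇔ ((¬ m γ) × m b × m c))
       × (¬ MinimalPair R (QuotmRmδ δ) (ppTrue R) (ppAnn R d))
       × (MinimalPair R (QuotmRmδ δ) (ppAnn R b) (ppDiv R c)
           ⇔ (InmRm (ι c) × InmRm (ι b) × SamePrincipal (ι (b * c)) (ι δ)))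
lemma5p4 R dom prüfer dense b c d m mmax γ γ≉0 δ _ δ≉0 =
    mk⇔ (≈ᵥ⇒SamePrincipal ∘ minimal-true-ann⇒≈ᵥ d) (≈ᵥ⇒minimal-true-ann d ∘ SamePrincipal⇒≈ᵥ)
  , mk⇔ (minimal-ann-div⇒∉m∈m∈m b c) (λ (γ∉m , b∈m , c∈m) → ∉m∈m∈m⇒minimal-ann-div b c γ∉m b∈m c∈m)
  , ¬minimal-true-ann d
  , mk⇔ (λ minimal → let c∈m , b∈m , bc≈ᵥδ = minimal-ann-div⇒∈m∈m≈ᵥ b c minimal in
                     ∈m⇒InmRm-ι c∈m , ∈m⇒InmRm-ι b∈m , ≈ᵥ⇒SamePrincipal bc≈ᵥδ)
        (λ (c∈mRm , b∈mRm , bc∼δ) →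
           ∈m∈m≈ᵥ⇒minimal-ann-div b c (InmRm-ι⇒∈m c∈mRm) (InmRm-ι⇒∈m b∈mRm) (SamePrincipal⇒≈ᵥ bc∼δ))
  where
  open AtMaximalIdeal R dom m mmax
  open InQuotγmRm (prüfer m mmax) (dense m mmax) γ γ≉0
  open InQuotmRmδ (prüfer m mmax) (dense m mmax) δ δ≉0
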